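{- For $n\ge4$, the number of permutations in $K_n$ that have no princes is $2^k k!$ if $n=4k$, and $0$ otherwise.
   Context: $K_n$ is the set of permutations $\sigma\in S_n$ (one-line notation $[\sigma_1,\dots,\sigma_n]$) with $|\sigma_i-\sigma_{i-1}|\neq1$ for all $2\le i\le n$. $\pi\prec\sigma$ means that some subsequence of $\sigma$ is order-isomorphic to $\pi$ and $\pi\ne\sigma$. A prince of $\sigma\in K_n$ is a $\tau\in K_{n-1}$ with $\tau\prec\sigma$. -}

module Defs where

open import Data.Nat using (ℕ; suc; _∸_; ∣_-_∣)
open import Data.Fin using (Fin; toℕ) renaming (_<_ to _<ᶠ_)
open import Data.Vec using (Vec; lookup)
open import Data.List using (List; length)
open import Data.List.Relation.Unary.Unique.Propositional using (Unique)
open import Data.List.Membership.Propositional using (_∈_)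
open import Data.Product using (Σ; ∃; _×_)
open import Function.Bundles using (_⇔_)
open import Relation.Nullary using (¬_)
open import Relation.Binary.PropositionalEquality using (_≡_; _≢_; subst)

-- A word of length n over {0,…,n-1}, read as one-line notation [σ₀,…,σₙ₋₁]
-- (values shifted down by one, which does not affect anything below).
OneLine : ℕ → Set
OneLine n = Vec (Fin n) n

IsPerm : ∀ {n} → OneLine n → Set
IsPerm {n} σ = ∀ (i j : Fin n) → lookup σ i ≡ lookup σ j → i ≡ j

InK : ∀ {n} → OneLine n → Set
InK {n} σ = ∀ (i j : Fin n) → toℕ j ≡ suc (toℕ i) →
            ∣ toℕ (lookup σ i) - toℕ (lookup σ j) ∣ ≢ 1

Occurs : ∀ {m n} → OneLine m → OneLine n → Set
Occurs {m} {n} π σ =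
  Σ (Fin m → Fin n) λ f →
    (∀ i j → i <ᶠ j → f i <ᶠ f j) ×
    (∀ i j → (lookup π i <ᶠ lookup π j) ⇔ (lookup σ (f i) <ᶠ lookup σ (f j)))

_≺_ : ∀ {m n} → OneLine m → OneLine n → Set
_≺_ {m} {n} π σ = Occurs π σ × ¬ (Σ (m ≡ n) λ e → subst OneLine e π ≡ σ)

IsPrince : ∀ {n} → OneLine n → OneLine (n ∸ 1) → Set
IsPrince σ τ = IsPerm τ × InK τ × (τ ≺ σ)

PrincelessK : ∀ {n} → OneLine n → Set
PrincelessK {n} σ = IsPerm σ × InK σ × ¬ (∃ λ (τ : OneLine (n ∸ 1)) → IsPrince σ τ)

HasCount : ∀ n → (OneLine n → Set) → ℕ → Set
HasCount n P c =
  Σ (List (OneLine n)) λ L → length L ≡ c × Unique L × (∀ σ → (σ ∈ L) ⇔ P σ)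

-- Deleting the entry at position p of σ ∈ K_n and standardising gives a prince unless the
-- deletion creates an adjacency: the neighbours of p carry adjacent values, or some adjacent
-- pair of entries carries the values σ_p ± 1. Every occurrence of a τ ∈ K_{n-1} arises this
-- way from the one position it misses, so σ is princeless iff every position is covered.
-- Scanning a covered word from the left, the first entry after a completed prefix of blocks
-- can only be covered as the middle of the entries two and three places further on, and
-- covering those forces a block: four consecutive values in the pattern 2413 or 3142. The
-- value just below a block is the top of another block, so the blocks are {4r, …, 4r + 3}.
-- Hence n = 4k, and the princeless words are the k! orders of the blocks times the 2^k
-- choices of pattern.

module Submission where

open import Defs
open import Data.Nat using (ℕ; zero; suc; pred; _+_; _*_; _∸_; _^_; _!; _≤_; _<_; z≤n; s≤s; ∣_-_∣; _≟_; _<?_)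
open import Data.Nat.Properties
open import Data.Nat.Divisibility using (_∣_; divides)
open import Data.Nat.Induction using (<-rec)
open import Data.Nat.Solver using (module +-*-Solver)
open import Data.Fin as Fin using (Fin; toℕ; fromℕ<; punchOut) renaming (_<_ to _<ᶠ_)
open import Data.Fin.Properties using (toℕ-injective; toℕ<n; toℕ-fromℕ<; any?; all?; ¬∀⟶∃¬; injective⇒≤; punchOut-injective) renaming (_≟_ to _≟ᶠ_)
open import Data.Vec using (Vec; []; _∷_; lookup; tabulate)
open import Data.Vec.Properties using (lookup∘tabulate)
open import Data.List using (List; []; _∷_; length; map; cartesianProductWith; cartesianProduct; allFin)
open import Data.List.Properties using (length-++; length-map; length-tabulate)
open import Data.List.Relation.Unary.Unique.Propositional using (Unique)
open import Data.List.Relation.Unary.Unique.Propositional.Properties using (cartesianProductWith⁺; cartesianProduct⁺; allFin⁺)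
open import Data.List.Relation.Unary.All using ([]; _∷_)
open import Data.List.Relation.Unary.AllPairs using ([]; _∷_)
open import Data.List.Relation.Unary.Any using (here; there)
open import Data.List.Membership.Propositional using (_∈_)
open import Data.List.Membership.Propositional.Properties using (∈-cartesianProductWith⁺; ∈-cartesianProductWith⁻; ∈-cartesianProduct⁺; ∈-allFin)
open import Data.Product using (_×_; _,_; proj₁; proj₂; Σ; ∃)
open import Data.Sum using (_⊎_; inj₁; inj₂)
open import Data.Empty using (⊥; ⊥-elim)
open import Function.Bundles using (_⇔_; Equivalence; mk⇔)
open import Relation.Nullary using (¬_; Dec; yes; no)
open import Relation.Nullary.Decidable using (map′; _×-dec_; _⊎-dec_)
open import Relation.Binary.PropositionalEquality
open import Relation.Binary.Definitions using (tri<; tri≈; tri>)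

data Dir : Set where
  up down : Dir

Step : Dir → ℕ → ℕ → Set
Step up   x y = suc x ≡ y
Step down x y = suc y ≡ x

Adjacent : ℕ → ℕ → Set
Adjacent x y = Σ Dir λ e → Step e x y

Consecutive : ℕ → ℕ → ℕ → Set
Consecutive x m y = Σ Dir λ e → Step e x m × Step e m y

opposite : Dir → Dir
opposite up   = down
opposite down = up

Step-opposite : ∀ e {x y} → Step e x y → Step (opposite e) y x
Step-opposite up   p = p
Step-opposite down p = p

Adjacent-sym : ∀ {x y} → Adjacent x y → Adjacent y x
Adjacent-sym (e , p) = opposite e , Step-opposite e p

Step-functional : ∀ e {x y z} → Step e x y → Step e x z → y ≡ z
Step-functional up   p q = trans (sym p) q
Step-functional down p q = suc-injective (trans p (sym q))

Step-injective : ∀ e {x y z} → Step e x z → Step e y z → x ≡ y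
Step-injective up   p q = suc-injective (trans p (sym q))
Step-injective down p q = trans (sym p) q

Precedes : Dir → ℕ → ℕ → Set
Precedes up   x y = x < y
Precedes down x y = y < x

Step⇒Precedes : ∀ e {x y} → Step e x y → Precedes e x y
Step⇒Precedes up   p = ≤-reflexive p
Step⇒Precedes down p = ≤-reflexive p

Precedes-trans : ∀ e {x y z} → Precedes e x y → Precedes e y z → Precedes e x z
Precedes-trans up   p q = <-trans p q
Precedes-trans down p q = <-trans q p

Precedes-irrefl : ∀ e {x} → ¬ Precedes e x x
Precedes-irrefl up   = <-irrefl refl
Precedes-irrefl down = <-irrefl refl

Step-irrefl : ∀ e {x} → ¬ Step e x x
Step-irrefl e p = Precedes-irrefl e (Step⇒Precedes e p)

no-Step-4-cycle : ∀ e {a b c d} → Step e a b → Step e b c → Step e c d → ¬ Step e d a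
no-Step-4-cycle e p q r s = Precedes-irrefl e
  (Precedes-trans e (Step⇒Precedes e p) (Precedes-trans e (Step⇒Precedes e q)
    (Precedes-trans e (Step⇒Precedes e r) (Step⇒Precedes e s))))

no-Step-5-cycle : ∀ e {a b c d g} → Step e a b → Step e b c → Step e c d → Step e d g → ¬ Step e g a
no-Step-5-cycle e p q r s t = Precedes-irrefl e
  (Precedes-trans e (Step⇒Precedes e p) (Precedes-trans e (Step⇒Precedes e q)
    (Precedes-trans e (Step⇒Precedes e r) (Precedes-trans e (Step⇒Precedes e s) (Step⇒Precedes e t)))))

adjacent-to-target : ∀ e {v t y} → Step e v t → Adjacent t y → y ≡ v ⊎ Step e t y
adjacent-to-target up   p (up   , q) = inj₂ q
adjacent-to-target up   p (down , q) = inj₁ (suc-injective (trans q (sym p)))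
adjacent-to-target down p (up   , q) = inj₁ (trans (sym q) p)
adjacent-to-target down p (down , q) = inj₂ q

adjacent-to-source : ∀ e {s v y} → Step e s v → Adjacent s y → y ≡ v ⊎ Step e y s
adjacent-to-source up   p (up   , q) = inj₁ (trans (sym q) p)
adjacent-to-source up   p (down , q) = inj₂ q
adjacent-to-source down p (up   , q) = inj₂ q
adjacent-to-source down p (down , q) = inj₁ (suc-injective (trans q (sym p)))

consecutive-around-source : ∀ e {s v a b} → Step e s v → Consecutive a s b →
                            (b ≡ v × Step e a s) ⊎ (a ≡ v × Step e b s)
consecutive-around-source up   p (up   , q , r) = inj₁ (trans (sym r) p , q)
consecutive-around-source up   p (down , q , r) = inj₂ (trans (sym q) p , r)
consecutive-around-source down p (up   , q , r) = inj₂ (suc-injective (trans q (sym p)) , r)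
consecutive-around-source down p (down , q , r) = inj₁ (suc-injective (trans r (sym p)) , q)

consecutive-around-target : ∀ e {v t a b} → Step e v t → Consecutive a t b →
                            (b ≡ v × Step e t a) ⊎ (a ≡ v × Step e t b)
consecutive-around-target up   p (up   , q , r) = inj₂ (suc-injective (trans q (sym p)) , r)
consecutive-around-target up   p (down , q , r) = inj₁ (suc-injective (trans r (sym p)) , q)
consecutive-around-target down p (up   , q , r) = inj₁ (trans (sym r) p , q)
consecutive-around-target down p (down , q , r) = inj₂ (trans (sym q) p , r)

Consecutive⇒Adjacentˡ : ∀ {a m b} → Consecutive a m b → Adjacent a m
Consecutive⇒Adjacentˡ (e , p , _) = e , p

Consecutive-≢ˡ : ∀ {x v y} → Consecutive x v y → x ≢ v
Consecutive-≢ˡ (e , s₁ , _) refl = Step-irrefl e s₁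

Consecutive-≢ʳ : ∀ {x v y} → Consecutive x v y → y ≢ v
Consecutive-≢ʳ (e , _ , s₂) refl = Step-irrefl e s₂

Adjacent-suc : ∀ {x y} → Adjacent x y → Adjacent (suc x) (suc y)
Adjacent-suc (up   , p) = up   , cong suc p
Adjacent-suc (down , p) = down , cong suc p

∣-∣≡1⇒Adjacent : ∀ x y → ∣ x - y ∣ ≡ 1 → Adjacent x y
∣-∣≡1⇒Adjacent zero    y       refl = up , refl
∣-∣≡1⇒Adjacent (suc x) zero    eq   = down , sym eq
∣-∣≡1⇒Adjacent (suc x) (suc y) eq   = Adjacent-suc (∣-∣≡1⇒Adjacent x y eq)

∣n-1+n∣≡1 : ∀ x → ∣ x - suc x ∣ ≡ 1
∣n-1+n∣≡1 zero    = refl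
∣n-1+n∣≡1 (suc x) = ∣n-1+n∣≡1 x

Adjacent⇒∣-∣≡1 : ∀ {x y} → Adjacent x y → ∣ x - y ∣ ≡ 1
Adjacent⇒∣-∣≡1 {x}     (up   , refl) = ∣n-1+n∣≡1 x
Adjacent⇒∣-∣≡1 {y = y} (down , refl) = trans (∣-∣-comm (suc y) y) (∣n-1+n∣≡1 y)

Adjacent-resp-≡ : ∀ {x x′ y y′} → x ≡ x′ → y ≡ y′ → Adjacent x′ y′ → Adjacent x y
Adjacent-resp-≡ refl refl a = a

Consecutive-resp-≡ : ∀ {x x′ y y′ z z′} → x ≡ x′ → y ≡ y′ → z ≡ z′ → Consecutive x′ y′ z′ → Consecutive x y z
Consecutive-resp-≡ refl refl refl a = a

Adjacent? : ∀ x y → Dec (Adjacent x y)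
Adjacent? x y = map′ to from (suc x ≟ y ⊎-dec suc y ≟ x)
  where
  to : suc x ≡ y ⊎ suc y ≡ x → Adjacent x y
  to (inj₁ p) = up , p
  to (inj₂ p) = down , p
  from : Adjacent x y → suc x ≡ y ⊎ suc y ≡ x
  from (up   , p) = inj₁ p
  from (down , p) = inj₂ p

Consecutive? : ∀ x v y → Dec (Consecutive x v y)
Consecutive? x v y = map′ to from ((suc x ≟ v ×-dec suc v ≟ y) ⊎-dec (suc v ≟ x ×-dec suc y ≟ v))
  where
  to : (suc x ≡ v × suc v ≡ y) ⊎ (suc v ≡ x × suc y ≡ v) → Consecutive x v y
  to (inj₁ (p , q)) = up , p , q
  to (inj₂ (p , q)) = down , p , q
  from : Consecutive x v y → (suc x ≡ v × suc v ≡ y) ⊎ (suc v ≡ x × suc y ≡ v)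
  from (up   , p , q) = inj₁ (p , q)
  from (down , p , q) = inj₂ (p , q)

predecessor< : ∀ {x y b} → y ≡ suc x → y < b → x < b
predecessor< refl y< = <-trans (n<1+n _) y<

InjectiveBelow : ℕ → (ℕ → ℕ) → Set
InjectiveBelow n f = ∀ p q → p < n → q < n → f p ≡ f q → p ≡ q

AdjacencyFree : ℕ → (ℕ → ℕ) → Set
AdjacencyFree n f = ∀ p → suc p < n → ¬ Adjacent (f p) (f (suc p))

-- Position p is covered when deleting the entry f p makes two remaining entries
-- adjacent after standardisation: either its two neighbours, or the two entries
-- at some q, q + 1 whose values straddle f p.
CoveredByNeighbours : ℕ → (ℕ → ℕ) → ℕ → Set
CoveredByNeighbours n f p = Σ ℕ λ p′ → p ≡ suc p′ × suc p < n × Adjacent (f p′) (f (suc p))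

CoveredAsMiddle : ℕ → (ℕ → ℕ) → ℕ → Set
CoveredAsMiddle n f p = Σ ℕ λ q → suc q < n × Consecutive (f q) (f p) (f (suc q))

Covered : ℕ → (ℕ → ℕ) → Set
Covered n f = ∀ p → p < n → CoveredByNeighbours n f p ⊎ CoveredAsMiddle n f p

CoveredByNeighbours? : ∀ n f p → Dec (CoveredByNeighbours n f p)
CoveredByNeighbours? n f zero = no λ ()
CoveredByNeighbours? n f (suc p) = map′ (λ (b , a) → p , refl , b , a) (λ { (_ , refl , b , a) → b , a })
  (suc (suc p) <? n ×-dec Adjacent? (f p) (f (suc (suc p))))

CoveredAsMiddle? : ∀ n f p → Dec (CoveredAsMiddle n f p)
CoveredAsMiddle? n f p = map′ (λ (q , _ , c) → q , c) (λ (q , c) → q , <-trans (n<1+n q) (proj₁ c) , c)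
  (anyUpTo? (λ q → suc q <? n ×-dec Consecutive? (f q) (f p) (f (suc q))) n)

nth : ∀ {n m} → Vec (Fin n) m → ℕ → ℕ
nth []       p       = 0
nth (x ∷ xs) zero    = toℕ x
nth (x ∷ xs) (suc p) = nth xs p

nth-lookup : ∀ {n m} (σ : Vec (Fin n) m) (i : Fin m) → nth σ (toℕ i) ≡ toℕ (lookup σ i)
nth-lookup (x ∷ xs) Fin.zero    = refl
nth-lookup (x ∷ xs) (Fin.suc i) = nth-lookup xs i

nth< : ∀ {n m} (σ : Vec (Fin n) m) p → p < m → nth σ p < n
nth< (x ∷ xs) zero    _        = toℕ<n x
nth< (x ∷ xs) (suc p) (s≤s lt) = nth< xs p lt

nth-ext : ∀ {n m} (σ τ : Vec (Fin n) m) → (∀ p → p < m → nth σ p ≡ nth τ p) → σ ≡ τ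
nth-ext []       []       _ = refl
nth-ext (x ∷ xs) (y ∷ ys) h =
  cong₂ _∷_ (toℕ-injective (h 0 (s≤s z≤n))) (nth-ext xs ys (λ p lt → h (suc p) (s≤s lt)))

clamp : (N : ℕ) → ℕ → Fin (suc N)
clamp zero    _       = Fin.zero
clamp (suc N) zero    = Fin.zero
clamp (suc N) (suc x) = Fin.suc (clamp N x)

toℕ-clamp : ∀ N x → x ≤ N → toℕ (clamp N x) ≡ x
toℕ-clamp zero    zero    _       = refl
toℕ-clamp (suc N) zero    _       = refl
toℕ-clamp (suc N) (suc x) (s≤s le) = cong suc (toℕ-clamp N x le)

tabulateClamped : (N m : ℕ) → (ℕ → ℕ) → Vec (Fin (suc N)) m
tabulateClamped N zero    g = []
tabulateClamped N (suc m) g = clamp N (g 0) ∷ tabulateClamped N m (λ p → g (suc p))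

nth-tabulateClamped : ∀ N m g p → p < m → g p ≤ N → nth (tabulateClamped N m g) p ≡ g p
nth-tabulateClamped N (suc m) g zero    _        le = toℕ-clamp N (g 0) le
nth-tabulateClamped N (suc m) g (suc p) (s≤s lt) le = nth-tabulateClamped N m (λ p → g (suc p)) p lt le

-- The word g 0, …, g (n - 1); entries out of range are replaced by junk.
oneLine : (n : ℕ) → (ℕ → ℕ) → OneLine n
oneLine zero    g = []
oneLine (suc N) g = tabulateClamped N (suc N) g

nth-oneLine : ∀ n g p → p < n → g p < n → nth (oneLine n g) p ≡ g p
nth-oneLine (suc N) g p lt glt = nth-tabulateClamped N (suc N) g p lt (≤-pred glt)

module _ {n : ℕ} (σ : OneLine n) where

  lookup-fromℕ< : ∀ {r} (r< : r < n) → toℕ (lookup σ (fromℕ< r<)) ≡ nth σ r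
  lookup-fromℕ< r< = trans (sym (nth-lookup σ (fromℕ< r<))) (cong (nth σ) (toℕ-fromℕ< r<))

  IsPerm⇒injectiveBelow : IsPerm σ → InjectiveBelow n (nth σ)
  IsPerm⇒injectiveBelow perm p q p< q< eq = begin
    p                    ≡⟨ toℕ-fromℕ< p< ⟨
    toℕ (fromℕ< p<)      ≡⟨ cong toℕ (perm _ _ (toℕ-injective lookup-eq)) ⟩
    toℕ (fromℕ< q<)      ≡⟨ toℕ-fromℕ< q< ⟩
    q                    ∎
    where
    open ≡-Reasoning
    lookup-eq : toℕ (lookup σ (fromℕ< p<)) ≡ toℕ (lookup σ (fromℕ< q<))
    lookup-eq = trans (lookup-fromℕ< p<) (trans eq (sym (lookup-fromℕ< q<)))

  injectiveBelow⇒IsPerm : InjectiveBelow n (nth σ) → IsPerm σ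
  injectiveBelow⇒IsPerm inj i j eq = toℕ-injective (inj (toℕ i) (toℕ j) (toℕ<n i) (toℕ<n j)
    (trans (nth-lookup σ i) (trans (cong toℕ eq) (sym (nth-lookup σ j)))))

  InK⇒adjacencyFree : InK σ → AdjacencyFree n (nth σ)
  InK⇒adjacencyFree ink p sp< adj =
    ink (fromℕ< p<) (fromℕ< sp<) (trans (toℕ-fromℕ< sp<) (cong suc (sym (toℕ-fromℕ< p<))))
      (trans (cong₂ ∣_-_∣ (lookup-fromℕ< p<) (lookup-fromℕ< sp<)) (Adjacent⇒∣-∣≡1 adj))
    where
    p< : p < n
    p< = <-trans (n<1+n p) sp<

  adjacencyFree⇒InK : AdjacencyFree n (nth σ) → InK σ
  adjacencyFree⇒InK free i j eq ab = free (toℕ i) (subst (_< n) eq (toℕ<n j))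
    (subst (λ z → Adjacent (nth σ (toℕ i)) (nth σ z)) eq
      (∣-∣≡1⇒Adjacent _ _ (trans (cong₂ ∣_-_∣ (nth-lookup σ i) (nth-lookup σ j)) ab)))

injective⇒surjective : ∀ {n} (g : Fin n → Fin n) → (∀ i j → g i ≡ g j → i ≡ j) → ∀ y → ∃ λ x → g x ≡ y
injective⇒surjective {suc m} g g-inj y with any? (λ x → g x ≟ᶠ y)
... | yes hit = hit
... | no miss = ⊥-elim (<-irrefl refl (injective⇒≤ {f = h} h-inj))
  where
  h : Fin (suc m) → Fin m
  h x = punchOut {i = y} {j = g x} (λ eq → miss (x , sym eq))
  h-inj : ∀ {a b} → h a ≡ h b → a ≡ b
  h-inj {a} {b} eq = g-inj a b (punchOut-injective (λ e → miss (a , sym e)) (λ e → miss (b , sym e)) eq)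

IsPerm⇒surjectiveBelow : ∀ {n} (σ : OneLine n) → IsPerm σ → ∀ x → x < n → ∃ λ p → p < n × nth σ p ≡ x
IsPerm⇒surjectiveBelow σ perm x x< with injective⇒surjective (lookup σ) perm (fromℕ< x<)
... | i , e = toℕ i , toℕ<n i , trans (nth-lookup σ i) (trans (cong toℕ e) (toℕ-fromℕ< x<))

punchInℕ : ℕ → ℕ → ℕ
punchInℕ zero    j       = suc j
punchInℕ (suc p) zero    = zero
punchInℕ (suc p) (suc j) = suc (punchInℕ p j)

punchInℕ-≢ : ∀ p j → punchInℕ p j ≢ p
punchInℕ-≢ zero    j       ()
punchInℕ-≢ (suc p) zero    ()
punchInℕ-≢ (suc p) (suc j) eq = punchInℕ-≢ p j (suc-injective eq)

punchInℕ≤1+ : ∀ p j → punchInℕ p j ≤ suc j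
punchInℕ≤1+ zero    j       = ≤-refl
punchInℕ≤1+ (suc p) zero    = z≤n
punchInℕ≤1+ (suc p) (suc j) = s≤s (punchInℕ≤1+ p j)

punchInℕ-mono-< : ∀ p {j j′} → j < j′ → punchInℕ p j < punchInℕ p j′
punchInℕ-mono-< zero                         lt       = s≤s lt
punchInℕ-mono-< (suc p) {zero}  {suc j′}     lt       = s≤s z≤n
punchInℕ-mono-< (suc p) {suc j} {suc j′}     (s≤s lt) = s≤s (punchInℕ-mono-< p lt)

punchInℕ-injective : ∀ p {j j′} → punchInℕ p j ≡ punchInℕ p j′ → j ≡ j′
punchInℕ-injective p {j} {j′} eq with <-cmp j j′
... | tri< lt _ _ = ⊥-elim (<-irrefl eq (punchInℕ-mono-< p lt))
... | tri≈ _ e _  = e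
... | tri> _ _ gt = ⊥-elim (<-irrefl (sym eq) (punchInℕ-mono-< p gt))

punchInℕ-suc : ∀ p j → punchInℕ p (suc j) ≡ suc (punchInℕ p j)
                     ⊎ (p ≡ suc j × punchInℕ p j ≡ j × punchInℕ p (suc j) ≡ suc (suc j))
punchInℕ-suc zero                j       = inj₁ refl
punchInℕ-suc (suc zero)          zero    = inj₂ (refl , refl , refl)
punchInℕ-suc (suc (suc p))       zero    = inj₁ refl
punchInℕ-suc (suc p)             (suc j) with punchInℕ-suc p j
... | inj₁ e                = inj₁ (cong suc e)
... | inj₂ (e₁ , e₂ , e₃)   = inj₂ (cong suc e₁ , cong suc e₂ , cong suc e₃)

punchOutℕ : ℕ → ℕ → ℕ
punchOutℕ zero    x       = pred x
punchOutℕ (suc v) zero    = zero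
punchOutℕ (suc v) (suc x) = suc (punchOutℕ v x)

punchOutℕ-cases : ∀ v x → x ≢ v → (x < v × punchOutℕ v x ≡ x) ⊎ (v < x × suc (punchOutℕ v x) ≡ x)
punchOutℕ-cases zero    zero    ne = ⊥-elim (ne refl)
punchOutℕ-cases zero    (suc x) ne = inj₂ (s≤s z≤n , refl)
punchOutℕ-cases (suc v) zero    ne = inj₁ (s≤s z≤n , refl)
punchOutℕ-cases (suc v) (suc x) ne with punchOutℕ-cases v x (λ e → ne (cong suc e))
... | inj₁ (lt , e) = inj₁ (s≤s lt , cong suc e)
... | inj₂ (lt , e) = inj₂ (s≤s lt , cong suc e)

punchOutℕ< : ∀ {m} v x → x ≢ v → x < suc m → v < suc m → punchOutℕ v x < m
punchOutℕ< {m} v x ne x< v< with punchOutℕ-cases v x ne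
... | inj₁ (lt , e) = subst (_< m) (sym e) (<-≤-trans lt (≤-pred v<))
... | inj₂ (lt , e) = subst (_≤ m) (sym e) (≤-pred x<)

<⇔punchOutℕ-< : ∀ v x y → x ≢ v → y ≢ v → (x < y) ⇔ (punchOutℕ v x < punchOutℕ v y)
<⇔punchOutℕ-< v x y x≢ y≢ with punchOutℕ-cases v x x≢ | punchOutℕ-cases v y y≢
... | inj₁ (_ , e) | inj₁ (_ , e′) = mk⇔ (subst₂ _<_ (sym e) (sym e′)) (subst₂ _<_ e e′)
... | inj₂ (_ , e) | inj₂ (_ , e′) = mk⇔ (λ lt → ≤-pred (subst₂ _<_ (sym e) (sym e′) lt)) (λ lt → subst₂ _<_ e e′ (s≤s lt))
... | inj₁ (a , e) | inj₂ (b , e′) =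
  mk⇔ (λ _ → subst (_< punchOutℕ v y) (sym e) (<-≤-trans a (≤-pred (subst (v <_) (sym e′) b)))) (λ _ → <-trans a b)
... | inj₂ (a , e) | inj₁ (b , e′) =
  mk⇔ (λ lt → ⊥-elim (<-asym lt (<-trans b a)))
      (λ lt → ⊥-elim (<-asym (subst (_< punchOutℕ v x) (sym e′) (<-≤-trans b (≤-pred (subst (v <_) (sym e) a)))) lt))

punchOutℕ-injective : ∀ v x y → x ≢ v → y ≢ v → punchOutℕ v x ≡ punchOutℕ v y → x ≡ y
punchOutℕ-injective v x y x≢ y≢ eq with <-cmp x y
... | tri< lt _ _ = ⊥-elim (<-irrefl eq (Equivalence.to (<⇔punchOutℕ-< v x y x≢ y≢) lt))
... | tri≈ _ e _  = e
... | tri> _ _ gt = ⊥-elim (<-irrefl (sym eq) (Equivalence.to (<⇔punchOutℕ-< v y x y≢ x≢) gt))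

punchOutℕ-adjacent : ∀ v x y → x ≢ v → y ≢ v → Adjacent (punchOutℕ v x) (punchOutℕ v y) →
                     Adjacent x y ⊎ Consecutive x v y
punchOutℕ-adjacent v x y x≢ y≢ adj with punchOutℕ-cases v x x≢ | punchOutℕ-cases v y y≢
... | inj₁ (_ , e) | inj₁ (_ , e′) = inj₁ (subst₂ Adjacent e e′ adj)
... | inj₂ (_ , e) | inj₂ (_ , e′) = inj₁ (subst₂ Adjacent e e′ (Adjacent-suc adj))
... | inj₁ (a , e) | inj₂ (b , e′) with subst (λ z → Adjacent z (punchOutℕ v y)) e adj
...   | up , r = inj₂ (up , 1+x≡v , trans (cong suc (sym 1+x≡v)) (trans (cong suc r) e′))
  where
  1+x≡v : suc x ≡ v
  1+x≡v = ≤-antisym a (subst (v ≤_) (sym r) (≤-pred (subst (v <_) (sym e′) b)))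
...   | down , r = ⊥-elim (<-irrefl refl (<-≤-trans a (≤-trans (≤-pred (subst (v <_) (sym e′) b))
                                                      (≤-trans (n≤1+n _) (≤-reflexive r)))))
punchOutℕ-adjacent v x y x≢ y≢ adj | inj₂ (a , e) | inj₁ (b , e′) with subst (Adjacent (punchOutℕ v x)) e′ adj
...   | down , r = inj₂ (down , trans (cong suc (sym 1+y≡v)) (trans (cong suc r) e) , 1+y≡v)
  where
  1+y≡v : suc y ≡ v
  1+y≡v = ≤-antisym b (subst (v ≤_) (sym r) (≤-pred (subst (v <_) (sym e) a)))
...   | up , r = ⊥-elim (<-irrefl refl (<-≤-trans b (≤-trans (≤-pred (subst (v <_) (sym e) a))
                                                    (≤-trans (n≤1+n _) (≤-reflexive r)))))

module Deletion {m : ℕ} (σ : OneLine (suc m)) (perm : IsPerm σ) (ink : InK σ) (p : ℕ) (p< : p < suc m)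
                (¬byNeighbours : ¬ CoveredByNeighbours (suc m) (nth σ) p)
                (¬asMiddle : ¬ CoveredAsMiddle (suc m) (nth σ) p) where

  s : ℕ → ℕ
  s = nth σ

  v : ℕ
  v = s p

  s-injective : InjectiveBelow (suc m) s
  s-injective = IsPerm⇒injectiveBelow σ perm

  s-free : AdjacencyFree (suc m) s
  s-free = InK⇒adjacencyFree σ ink

  punchInℕ< : ∀ j → j < m → punchInℕ p j < suc m
  punchInℕ< j j< = s≤s (≤-trans (punchInℕ≤1+ p j) j<)

  s≢v : ∀ j → j < m → s (punchInℕ p j) ≢ v
  s≢v j j< e = punchInℕ-≢ p j (s-injective _ _ (punchInℕ< j j<) p< e)

  reduced : ℕ → ℕ
  reduced j = punchOutℕ v (s (punchInℕ p j))

  reduced< : ∀ j → j < m → reduced j < m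
  reduced< j j< = punchOutℕ< v (s (punchInℕ p j)) (s≢v j j<) (nth< σ _ (punchInℕ< j j<)) (nth< σ p p<)

  τ : OneLine m
  τ = oneLine m reduced

  nth-τ : ∀ j → j < m → nth τ j ≡ reduced j
  nth-τ j j< = nth-oneLine m reduced j j< (reduced< j j<)

  τ-injective : InjectiveBelow m (nth τ)
  τ-injective a b a< b< e = punchInℕ-injective p (s-injective _ _ (punchInℕ< a a<) (punchInℕ< b b<)
    (punchOutℕ-injective v _ _ (s≢v a a<) (s≢v b b<) (trans (sym (nth-τ a a<)) (trans e (nth-τ b b<)))))

  τ-free : AdjacencyFree m (nth τ)
  τ-free j sj< adj
    with punchOutℕ-adjacent v _ _ (s≢v j j<) (s≢v (suc j) sj<)
           (subst₂ Adjacent (nth-τ j j<) (nth-τ (suc j) sj<) adj)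
       | punchInℕ-suc p j
    where
    j< : j < m
    j< = <-trans (n<1+n j) sj<
  ... | inj₁ a  | inj₁ e = s-free (punchInℕ p j) (subst (_< suc m) e (punchInℕ< (suc j) sj<))
                                  (subst (λ z → Adjacent (s (punchInℕ p j)) (s z)) e a)
  ... | inj₂ md | inj₁ e = ¬asMiddle (punchInℕ p j , subst (_< suc m) e (punchInℕ< (suc j) sj<) ,
                                      subst (λ z → Consecutive (s (punchInℕ p j)) v (s z)) e md)
  ... | inj₁ a  | inj₂ (e₁ , e₂ , e₃) =
    ¬byNeighbours (j , e₁ , subst (λ z → suc z < suc m) (sym e₁) (subst (_< suc m) e₃ (punchInℕ< (suc j) sj<)) ,
                   subst (λ z → Adjacent (s j) (s (suc z))) (sym e₁) (subst₂ (λ x y → Adjacent (s x) (s y)) e₂ e₃ a))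
  ... | inj₂ md | inj₂ (e₁ , e₂ , e₃) =
    s-free j (subst (_< suc m) e₁ p<) (subst₂ (λ x y → Adjacent (s x) (s y)) e₂ e₁ (Consecutive⇒Adjacentˡ md))

  embedding : Fin m → Fin (suc m)
  embedding j = clamp m (punchInℕ p (toℕ j))

  toℕ-embedding : ∀ j → toℕ (embedding j) ≡ punchInℕ p (toℕ j)
  toℕ-embedding j = toℕ-clamp m _ (≤-pred (punchInℕ< (toℕ j) (toℕ<n j)))

  τ-occurs : Occurs τ σ
  τ-occurs = embedding , embedding-mono , order-iso
    where
    embedding-mono : ∀ i j → i <ᶠ j → embedding i <ᶠ embedding j
    embedding-mono i j lt = subst₂ _<_ (sym (toℕ-embedding i)) (sym (toℕ-embedding j)) (punchInℕ-mono-< p lt)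
    τ-at : ∀ i → toℕ (lookup τ i) ≡ reduced (toℕ i)
    τ-at i = trans (sym (nth-lookup τ i)) (nth-τ (toℕ i) (toℕ<n i))
    σ-at : ∀ i → toℕ (lookup σ (embedding i)) ≡ s (punchInℕ p (toℕ i))
    σ-at i = trans (sym (nth-lookup σ (embedding i))) (cong s (toℕ-embedding i))
    order-iso : ∀ i j → (lookup τ i <ᶠ lookup τ j) ⇔ (lookup σ (embedding i) <ᶠ lookup σ (embedding j))
    order-iso i j = mk⇔
      (λ lt → subst₂ _<_ (sym (σ-at i)) (sym (σ-at j)) (Equivalence.from ord (subst₂ _<_ (τ-at i) (τ-at j) lt)))
      (λ lt → subst₂ _<_ (sym (τ-at i)) (sym (τ-at j)) (Equivalence.to ord (subst₂ _<_ (σ-at i) (σ-at j) lt)))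
      where
      ord : (s (punchInℕ p (toℕ i)) < s (punchInℕ p (toℕ j))) ⇔ (reduced (toℕ i) < reduced (toℕ j))
      ord = <⇔punchOutℕ-< v _ _ (s≢v (toℕ i) (toℕ<n i)) (s≢v (toℕ j) (toℕ<n j))

  τ-prince : IsPrince σ τ
  τ-prince = injectiveBelow⇒IsPerm τ τ-injective , adjacencyFree⇒InK τ τ-free , τ-occurs ,
             λ (e , _) → <-irrefl e (n<1+n m)

missed : ∀ {m} (F : Fin m → Fin (suc m)) → (∀ i j → F i ≡ F j → i ≡ j) → ∃ λ y → ∀ x → F x ≢ y
missed {m} F F-inj with all? (λ y → any? (λ x → F x ≟ᶠ y))
... | yes hit = ⊥-elim (<-irrefl refl (injective⇒≤ {f = preimage} preimage-inj))
  where
  preimage : Fin (suc m) → Fin m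
  preimage y = proj₁ (hit y)
  preimage-inj : ∀ {a b} → preimage a ≡ preimage b → a ≡ b
  preimage-inj {a} {b} eq = trans (sym (proj₂ (hit a))) (trans (cong F eq) (proj₂ (hit b)))
... | no ¬all with ¬∀⟶∃¬ (suc m) _ (λ y → any? (λ x → F x ≟ᶠ y)) ¬all
...   | y , ¬hit = y , λ x e → ¬hit (x , e)

nothing-strictly-between-n-1+n : ∀ {x z} → x < z → z < suc x → ⊥
nothing-strictly-between-n-1+n lt₁ lt₂ = <-irrefl refl (<-≤-trans lt₁ (≤-pred lt₂))

strictly-between-n-2+n : ∀ {x z} → x < z → z < suc (suc x) → z ≡ suc x
strictly-between-n-2+n lt₁ lt₂ = ≤-antisym (≤-pred lt₂) lt₁

module Occurrence {m : ℕ} (σ : OneLine (suc m)) (perm : IsPerm σ)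
                  (τ : OneLine m) (permτ : IsPerm τ) (inkτ : InK τ)
                  (F : Fin m → Fin (suc m)) (F-mono : ∀ i j → i <ᶠ j → F i <ᶠ F j)
                  (F-iso : ∀ i j → (lookup τ i <ᶠ lookup τ j) ⇔ (lookup σ (F i) <ᶠ lookup σ (F j))) where

  s t g : ℕ → ℕ
  s = nth σ
  t = nth τ
  g = nth (tabulate F)

  s-injective : InjectiveBelow (suc m) s
  s-injective = IsPerm⇒injectiveBelow σ perm

  t-free : AdjacencyFree m t
  t-free = InK⇒adjacencyFree τ inkτ

  g-at : ∀ a (a< : a < m) → g a ≡ toℕ (F (fromℕ< a<))
  g-at a a< = trans (cong g (sym (toℕ-fromℕ< a<)))
                    (trans (nth-lookup (tabulate F) (fromℕ< a<)) (cong toℕ (lookup∘tabulate F _)))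

  sg-at : ∀ a (a< : a < m) → s (g a) ≡ toℕ (lookup σ (F (fromℕ< a<)))
  sg-at a a< = trans (cong s (g-at a a<)) (nth-lookup σ _)

  g-mono : ∀ a b → a < m → b < m → a < b → g a < g b
  g-mono a b a< b< lt = subst₂ _<_ (sym (g-at a a<)) (sym (g-at b b<))
    (F-mono (fromℕ< a<) (fromℕ< b<) (subst₂ _<_ (sym (toℕ-fromℕ< a<)) (sym (toℕ-fromℕ< b<)) lt))

  g< : ∀ a → a < m → g a < suc m
  g< a a< = subst (_< suc m) (sym (g-at a a<)) (toℕ<n _)

  F-injective : ∀ i j → F i ≡ F j → i ≡ j
  F-injective i j eq with <-cmp (toℕ i) (toℕ j)
  ... | tri< lt _ _ = ⊥-elim (<-irrefl (cong toℕ eq) (F-mono i j lt))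
  ... | tri≈ _ e _  = toℕ-injective e
  ... | tri> _ _ gt = ⊥-elim (<-irrefl (cong toℕ (sym eq)) (F-mono j i gt))

  iso : ∀ a b → (a< : a < m) → (b< : b < m) → (t a < t b) ⇔ (s (g a) < s (g b))
  iso a b a< b< = mk⇔
    (λ lt → subst₂ _<_ (sym (sg-at a a<)) (sym (sg-at b b<)) (Equivalence.to (F-iso _ _) (subst₂ _<_ (t-at a<) (t-at b<) lt)))
    (λ lt → subst₂ _<_ (sym (t-at a<)) (sym (t-at b<)) (Equivalence.from (F-iso _ _) (subst₂ _<_ (sg-at a a<) (sg-at b b<) lt)))
    where
    t-at : ∀ {c} (c< : c < m) → t c ≡ toℕ (lookup τ (fromℕ< c<))
    t-at c< = sym (lookup-fromℕ< τ c<)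

  NoValueBetween : ℕ → ℕ → Set
  NoValueBetween x y = ∀ c → c < m → x < s (g c) → s (g c) < y → ⊥

  -- τ is a permutation, so a value t a + 1 < t b would be the image of a position between.
  value-gap : ∀ a b → a < m → b < m → s (g a) < s (g b) → NoValueBetween (s (g a)) (s (g b)) → t b ≡ suc (t a)
  value-gap a b a< b< lt none with <-cmp (suc (t a)) (t b) | Equivalence.from (iso a b a< b<) lt
  ... | tri≈ _ e _  | _   = sym e
  ... | tri> _ _ gt | tab = ⊥-elim (<-irrefl refl (<-≤-trans tab (≤-pred gt)))
  ... | tri< lt′ _ _ | tab with IsPerm⇒surjectiveBelow τ permτ (suc (t a)) (<-trans lt′ (nth< τ b b<))
  ...   | c , c< , e = ⊥-elim (none c c< (Equivalence.to (iso a c a< c<) (subst (t a <_) (sym e) ≤-refl))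
                                        (Equivalence.to (iso c b c< b<) (subst (_< t b) (sym e) lt′)))

  position-gap : ∀ a b → a < m → b < m → g a < g b → (∀ c → c < m → g a < g c → g c < g b → ⊥) → b ≡ suc a
  position-gap a b a< b< lt none with <-cmp a b
  ... | tri≈ _ refl _ = ⊥-elim (<-irrefl refl lt)
  ... | tri> _ _ gt   = ⊥-elim (<-asym lt (g-mono b a b< a< gt))
  ... | tri< ab _ _ with <-cmp (suc a) b
  ...   | tri≈ _ e _  = sym e
  ...   | tri> _ _ gt = ⊥-elim (<-irrefl refl (<-≤-trans ab (≤-pred gt)))
  ...   | tri< lt′ _ _ = ⊥-elim (none (suc a) (<-trans lt′ b<) (g-mono a (suc a) a< (<-trans lt′ b<) ≤-refl)
                                                             (g-mono (suc a) b (<-trans lt′ b<) b< lt′))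

  no-adjacent-successors : ∀ a → suc a < m → ¬ Adjacent (s (g a)) (s (g (suc a)))
  no-adjacent-successors a sa< (up , e) = t-free a sa< (up ,
    sym (value-gap a (suc a) a< sa< (≤-reflexive e) (λ c _ x y → nothing-strictly-between-n-1+n x (subst (s (g c) <_) (sym e) y))))
    where
    a< : a < m
    a< = <-trans (n<1+n a) sa<
  no-adjacent-successors a sa< (down , e) = t-free a sa< (down ,
    sym (value-gap (suc a) a sa< a< (≤-reflexive e) (λ c _ x y → nothing-strictly-between-n-1+n x (subst (s (g c) <_) (sym e) y))))
    where
    a< : a < m
    a< = <-trans (n<1+n a) sa<

  no-straddling-successors : ∀ a v → suc a < m → Consecutive (s (g a)) v (s (g (suc a))) →
                             (∀ c → c < m → s (g c) ≢ v) → ⊥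
  no-straddling-successors a v sa< (up , e₁ , e₂) v-missed = t-free a sa< (up ,
    sym (value-gap a (suc a) a< sa< (subst (s (g a) <_) e₂ (≤-trans (≤-reflexive e₁) (n≤1+n _)))
      (λ c c< x y → v-missed c c< (trans (strictly-between-n-2+n x (subst (s (g c) <_) (trans (sym e₂) (cong suc (sym e₁))) y)) e₁))))
    where
    a< : a < m
    a< = <-trans (n<1+n a) sa<
  no-straddling-successors a v sa< (down , e₁ , e₂) v-missed = t-free a sa< (down ,
    sym (value-gap (suc a) a sa< a< (subst (s (g (suc a)) <_) e₁ (≤-trans (≤-reflexive e₂) (n≤1+n _)))
      (λ c c< x y → v-missed c c< (trans (strictly-between-n-2+n x (subst (s (g c) <_) (trans (sym e₁) (cong suc (sym e₂))) y)) e₂))))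
    where
    a< : a < m
    a< = <-trans (n<1+n a) sa<

  module _ (y : Fin (suc m)) (y-missed : ∀ x → F x ≢ y) where

    i : ℕ
    i = toℕ y

    g≢i : ∀ a → a < m → g a ≢ i
    g≢i a a< eq = y-missed (fromℕ< a<) (toℕ-injective (trans (sym (g-at a a<)) eq))

    y≢fromℕ< : ∀ {x} (x< : x < suc m) → x ≢ i → y ≢ fromℕ< x<
    y≢fromℕ< x< x≢i e = x≢i (trans (sym (toℕ-fromℕ< x<)) (cong toℕ (sym e)))

    F≢y : ∀ a → y ≢ F a
    F≢y a e = y-missed a (sym e)

    F′ : Fin m → Fin m
    F′ a = punchOut (F≢y a)

    F′-injective : ∀ a b → F′ a ≡ F′ b → a ≡ b
    F′-injective a b eq = F-injective a b (punchOut-injective (F≢y a) (F≢y b) eq)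

    g-hits : ∀ x → x < suc m → x ≢ i → ∃ λ a → a < m × g a ≡ x
    g-hits x x< x≢i with injective⇒surjective F′ F′-injective (punchOut (y≢fromℕ< x< x≢i))
    ... | a , e = toℕ a , toℕ<n a , (begin
      g (toℕ a)                        ≡⟨ g-at (toℕ a) (toℕ<n a) ⟩
      toℕ (F (fromℕ< (toℕ<n a)))       ≡⟨ cong (λ z → toℕ (F z)) (toℕ-injective (toℕ-fromℕ< (toℕ<n a))) ⟩
      toℕ (F a)                        ≡⟨ cong toℕ (punchOut-injective (F≢y a) (y≢fromℕ< x< x≢i) e) ⟩
      toℕ (fromℕ< x<)                  ≡⟨ toℕ-fromℕ< x< ⟩
      x                                ∎)
      where open ≡-Reasoning

    missed-position-uncovered : Covered (suc m) s → ⊥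
    missed-position-uncovered cov with cov i (toℕ<n y)
    ... | inj₁ (i′ , i≡ , si< , adj)
      with g-hits i′ (predecessor< i≡ (toℕ<n y)) (λ e → <-irrefl (trans e i≡) (n<1+n i′))
         | g-hits (suc i) si< (λ e → <-irrefl (sym e) (n<1+n i))
    ...   | a , a< , ga | b , b< , gb with b≡1+a
      where
      b≡1+a : b ≡ suc a
      b≡1+a = position-gap a b a< b<
        (subst₂ _<_ (sym ga) (sym gb) (subst (i′ <_) (sym (cong suc i≡)) (<-trans (n<1+n i′) (n<1+n (suc i′)))))
        (λ c c< x z → g≢i c c< (trans (strictly-between-n-2+n (subst (_< g c) ga x) (subst (g c <_) (trans gb (cong suc i≡)) z)) (sym i≡)))
    ...     | refl = no-adjacent-successors a b< (subst₂ Adjacent (cong s (sym ga)) (cong s (sym gb)) adj)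
    missed-position-uncovered cov | inj₂ (q , sq< , mid)
      with g-hits q (<-trans (n<1+n q) sq<) (λ e → Consecutive-≢ˡ mid (cong s e))
         | g-hits (suc q) sq< (λ e → Consecutive-≢ʳ mid (cong s e))
    ...   | a , a< , ga | b , b< , gb with b≡1+a
      where
      b≡1+a : b ≡ suc a
      b≡1+a = position-gap a b a< b< (subst₂ _<_ (sym ga) (sym gb) ≤-refl)
        (λ c c< x z → nothing-strictly-between-n-1+n (subst (_< g c) ga x) (subst (g c <_) gb z))
    ...     | refl = no-straddling-successors a (s i) b<
                       (subst₂ (λ x z → Consecutive x (s i) z) (cong s (sym ga)) (cong s (sym gb)) mid)
                       (λ c c< e → g≢i c c< (s-injective (g c) i (g< c c<) (toℕ<n y) e))

  covered⇒¬occurs : Covered (suc m) s → ⊥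
  covered⇒¬occurs = missed-position-uncovered (proj₁ (missed F F-injective)) (proj₂ (missed F F-injective))

module _ {m : ℕ} (σ : OneLine (suc m)) (perm : IsPerm σ) where

  covered⇒princeless : Covered (suc m) (nth σ) → ¬ (∃ λ (τ : OneLine m) → IsPrince σ τ)
  covered⇒princeless cov (τ , permτ , inkτ , (F , mono , iso) , _) =
    Occurrence.covered⇒¬occurs σ perm τ permτ inkτ F mono iso cov

  princeless⇒covered : InK σ → ¬ (∃ λ (τ : OneLine m) → IsPrince σ τ) → Covered (suc m) (nth σ)
  princeless⇒covered ink no-prince p p<
    with CoveredByNeighbours? _ (nth σ) p | CoveredAsMiddle? _ (nth σ) p
  ... | yes a | _     = inj₁ a
  ... | no _  | yes b = inj₂ b
  ... | no ¬a | no ¬b = ⊥-elim (no-prince (Deletion.τ σ perm ink p p< ¬a ¬b , Deletion.τ-prince σ perm ink p p< ¬a ¬b))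

-- 4 * k by recursion on k, so that four (suc k) unfolds to four successors of four k.
four : ℕ → ℕ
four zero    = 0
four (suc k) = suc (suc (suc (suc (four k))))

four≡4* : ∀ k → four k ≡ 4 * k
four≡4* zero    = refl
four≡4* (suc k) = trans (cong (λ z → suc (suc (suc (suc z)))) (four≡4* k)) (sym (*-suc 4 k))

four-injective : ∀ {q q′} → four q ≡ four q′ → q ≡ q′
four-injective {q} {q′} e = *-cancelˡ-≡ q q′ 4 (trans (sym (four≡4* q)) (trans e (four≡4* q′)))

four-mono-≤ : ∀ {q m} → q ≤ m → four q ≤ four m
four-mono-≤ {zero}  {m}     _        = z≤n
four-mono-≤ {suc q} {suc m} (s≤s le) = s≤s (s≤s (s≤s (s≤s (four-mono-≤ le))))

four-mono-< : ∀ {q m} → q < m → 4 + four q ≤ four m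
four-mono-< {q} {suc m} (s≤s le) = s≤s (s≤s (s≤s (s≤s (four-mono-≤ le))))

0<4 : 0 < 4
0<4 = s≤s z≤n

1<4 : 1 < 4
1<4 = s≤s (s≤s z≤n)

2<4 : 2 < 4
2<4 = s≤s (s≤s (s≤s z≤n))

3<4 : 3 < 4
3<4 = s≤s (s≤s (s≤s (s≤s z≤n)))

+-suc⁴ : ∀ i x → i + suc (suc (suc (suc x))) ≡ suc (suc (suc (suc (i + x))))
+-suc⁴ zero    x = refl
+-suc⁴ (suc i) x = cong suc (+-suc⁴ i x)

divMod4 : ∀ q → ∃ λ q′ → ∃ λ i → i < 4 × q ≡ i + four q′
divMod4 zero                         = 0 , 0 , 0<4 , refl
divMod4 (suc zero)                   = 0 , 1 , 1<4 , refl
divMod4 (suc (suc zero))             = 0 , 2 , 2<4 , refl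
divMod4 (suc (suc (suc zero)))       = 0 , 3 , 3<4 , refl
divMod4 (suc (suc (suc (suc q)))) with divMod4 q
... | q′ , i , i< , eq = suc q′ , i , i< , trans (cong (λ z → suc (suc (suc (suc z)))) eq) (sym (+-suc⁴ i (four q′)))

+four-cancel-< : ∀ {i q m} → i + four q < four m → q < m
+four-cancel-< {i} {q} {m} lt with <-cmp q m
... | tri< a _ _    = a
... | tri≈ _ refl _ = ⊥-elim (<-irrefl refl (≤-trans lt (m≤n+m (four q) i)))
... | tri> _ _ c    = ⊥-elim (<-irrefl refl (<-≤-trans (≤-trans lt (four-mono-≤ (<⇒≤ c))) (m≤n+m (four q) i)))

+four-mono-< : ∀ {q i m} → q < m → i < 4 → i + four q < four m
+four-mono-< {q} q< i< = ≤-trans (+-monoˡ-< (four q) i<) (four-mono-< q<)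

divMod4-unique : ∀ {i i′ q q′} → i < 4 → i′ < 4 → i + four q ≡ i′ + four q′ → q ≡ q′
divMod4-unique {i} {i′} {q} {q′} lt lt′ eq with <-cmp q q′
... | tri≈ _ e _ = e
... | tri< a _ _ = ⊥-elim (<-irrefl eq (<-≤-trans (+four-mono-< a lt) (m≤n+m (four q′) i′)))
... | tri> _ _ c = ⊥-elim (<-irrefl (sym eq) (<-≤-trans (+four-mono-< c lt′) (m≤n+m (four q) i)))

-- Read in the position order P + 2, P, P + 3, P + 1, a block is a run of three steps in
-- direction e through the values c, …, c + 3: the pattern 2413 for e = up, 3142 for e = down.
blockPattern : Dir → ℕ → ℕ
blockPattern up   0 = 1
blockPattern up   1 = 3
blockPattern up   2 = 0
blockPattern up   _ = 2
blockPattern down 0 = 2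
blockPattern down 1 = 0
blockPattern down 2 = 3
blockPattern down _ = 1

blockPattern⁻¹ : Dir → ℕ → ℕ
blockPattern⁻¹ up   0 = 2
blockPattern⁻¹ up   1 = 0
blockPattern⁻¹ up   2 = 3
blockPattern⁻¹ up   _ = 1
blockPattern⁻¹ down 0 = 1
blockPattern⁻¹ down 1 = 3
blockPattern⁻¹ down 2 = 0
blockPattern⁻¹ down _ = 2

blockPattern< : ∀ e i → blockPattern e i < 4
blockPattern< up   0                   = 1<4
blockPattern< up   1                   = 3<4
blockPattern< up   2                   = 0<4
blockPattern< up   (suc (suc (suc _))) = 2<4
blockPattern< down 0                   = 2<4
blockPattern< down 1                   = 0<4
blockPattern< down 2                   = 3<4
blockPattern< down (suc (suc (suc _))) = 1<4

blockPattern⁻¹< : ∀ e d → blockPattern⁻¹ e d < 4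
blockPattern⁻¹< up   0                   = 2<4
blockPattern⁻¹< up   1                   = 0<4
blockPattern⁻¹< up   2                   = 3<4
blockPattern⁻¹< up   (suc (suc (suc _))) = 1<4
blockPattern⁻¹< down 0                   = 1<4
blockPattern⁻¹< down 1                   = 3<4
blockPattern⁻¹< down 2                   = 0<4
blockPattern⁻¹< down (suc (suc (suc _))) = 2<4

blockPattern-inverseˡ : ∀ e i → i < 4 → blockPattern⁻¹ e (blockPattern e i) ≡ i
blockPattern-inverseˡ up   0 _ = refl
blockPattern-inverseˡ up   1 _ = refl
blockPattern-inverseˡ up   2 _ = refl
blockPattern-inverseˡ up   3 _ = refl
blockPattern-inverseˡ down 0 _ = refl
blockPattern-inverseˡ down 1 _ = refl
blockPattern-inverseˡ down 2 _ = refl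
blockPattern-inverseˡ down 3 _ = refl
blockPattern-inverseˡ _    (suc (suc (suc (suc _)))) (s≤s (s≤s (s≤s (s≤s ()))))

blockPattern-inverseʳ : ∀ e d → d < 4 → blockPattern e (blockPattern⁻¹ e d) ≡ d
blockPattern-inverseʳ up   0 _ = refl
blockPattern-inverseʳ up   1 _ = refl
blockPattern-inverseʳ up   2 _ = refl
blockPattern-inverseʳ up   3 _ = refl
blockPattern-inverseʳ down 0 _ = refl
blockPattern-inverseʳ down 1 _ = refl
blockPattern-inverseʳ down 2 _ = refl
blockPattern-inverseʳ down 3 _ = refl
blockPattern-inverseʳ _    (suc (suc (suc (suc _)))) (s≤s (s≤s (s≤s (s≤s ()))))

record Block (f : ℕ → ℕ) (P c : ℕ) (e : Dir) : Set where
  constructor block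
  field
    at₀ : f P       ≡ blockPattern e 0 + c
    at₁ : f (1 + P) ≡ blockPattern e 1 + c
    at₂ : f (2 + P) ≡ blockPattern e 2 + c
    at₃ : f (3 + P) ≡ blockPattern e 3 + c

open Block

SomeBlock : (ℕ → ℕ) → ℕ → Set
SomeBlock f P = ∃ λ c → ∃ λ e → Block f P c e

InBlock : (ℕ → ℕ) → ℕ → ℕ → Set
InBlock f P x = ∃ λ i → i < 4 × f (i + P) ≡ x

module _ {f : ℕ → ℕ} {P c : ℕ} {e : Dir} where

  Block-at : Block f P c e → ∀ i → i < 4 → f (i + P) ≡ blockPattern e i + c
  Block-at (block e₀ e₁ e₂ e₃) 0 _ = e₀
  Block-at (block e₀ e₁ e₂ e₃) 1 _ = e₁
  Block-at (block e₀ e₁ e₂ e₃) 2 _ = e₂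
  Block-at (block e₀ e₁ e₂ e₃) 3 _ = e₃
  Block-at _ (suc (suc (suc (suc _)))) (s≤s (s≤s (s≤s (s≤s ()))))

  Block-from : (∀ i → i < 4 → f (i + P) ≡ blockPattern e i + c) → Block f P c e
  Block-from h = block (h 0 0<4) (h 1 1<4) (h 2 2<4) (h 3 3<4)

  Block-covers : Block f P c e → ∀ d → d < 4 → InBlock f P (d + c)
  Block-covers B d d< = blockPattern⁻¹ e d , blockPattern⁻¹< e d ,
    trans (Block-at B _ (blockPattern⁻¹< e d)) (cong (_+ c) (blockPattern-inverseʳ e d d<))

  Block-values : Block f P c e → ∀ i → i < 4 → ∃ λ d → d < 4 × f (i + P) ≡ d + c
  Block-values B i i< = blockPattern e i , blockPattern< e i , Block-at B i i<

module _ {f : ℕ → ℕ} {P c : ℕ} where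

  Block-adjacent-first : ∀ e {y} → Block f P c e → Adjacent (f P) y → InBlock f P y
  Block-adjacent-first up {y} (block e₀ _ e₂ e₃) adj with subst (λ x → Adjacent x y) e₀ adj
  ... | up   , refl = 3 , 3<4 , e₃
  ... | down , refl = 2 , 2<4 , e₂
  Block-adjacent-first down {y} (block e₀ _ e₂ e₃) adj with subst (λ x → Adjacent x y) e₀ adj
  ... | up   , refl = 2 , 2<4 , e₂
  ... | down , refl = 3 , 3<4 , e₃

  Block-adjacent-last : ∀ e {y} → Block f P c e → Adjacent (f (3 + P)) y → InBlock f P y
  Block-adjacent-last up {y} (block e₀ e₁ _ e₃) adj with subst (λ x → Adjacent x y) e₃ adj
  ... | up   , refl = 1 , 1<4 , e₁
  ... | down , refl = 0 , 0<4 , e₀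
  Block-adjacent-last down {y} (block e₀ e₁ _ e₃) adj with subst (λ x → Adjacent x y) e₃ adj
  ... | up   , refl = 0 , 0<4 , e₀
  ... | down , refl = 1 , 1<4 , e₁

  Block-¬consecutive₁₂ : ∀ e {y} → Block f P c e → ¬ Consecutive (f (1 + P)) y (f (2 + P))
  Block-¬consecutive₁₂ up {y} (block _ e₁ e₂ _) mid with subst₂ (λ a b → Consecutive a y b) e₁ e₂ mid
  ... | up   , refl , ()
  ... | down , refl , ()
  Block-¬consecutive₁₂ down {y} (block _ e₁ e₂ _) mid with subst₂ (λ a b → Consecutive a y b) e₁ e₂ mid
  ... | up   , refl , ()
  ... | down , refl , ()

  Block-consecutive₂₃ : ∀ e {y} → Block f P c e → Consecutive (f (2 + P)) y (f (3 + P)) → InBlock f P y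
  Block-consecutive₂₃ up {y} (block e₀ _ e₂ e₃) mid with subst₂ (λ a b → Consecutive a y b) e₂ e₃ mid
  ... | up   , refl , _ = 0 , 0<4 , e₀
  ... | down , refl , ()
  Block-consecutive₂₃ down {y} (block e₀ _ e₂ e₃) mid with subst₂ (λ a b → Consecutive a y b) e₂ e₃ mid
  ... | up   , refl , ()
  ... | down , refl , _ = 0 , 0<4 , e₀

Block-base-unique : ∀ {f P c c′ e e′} → Block f P c e → Block f P c′ e′ → c ≡ c′
Block-base-unique {e = up}   {up}   B B′ = suc-injective (trans (sym (at₀ B)) (at₀ B′))
Block-base-unique {e = down} {down} B B′ = suc-injective (suc-injective (trans (sym (at₀ B)) (at₀ B′)))
Block-base-unique {c = c} {c′} {up} {down} B B′ =
  ⊥-elim (m≢1+n+m c′ (trans (sym (at₁ B′)) (trans (at₁ B) (cong (3 +_) c≡1+c′))))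
  where
  c≡1+c′ : c ≡ suc c′
  c≡1+c′ = suc-injective (trans (sym (at₀ B)) (at₀ B′))
Block-base-unique {c = c} {c′} {down} {up} B B′ =
  ⊥-elim (m≢1+n+m c (trans (sym (at₁ B)) (trans (at₁ B′) (cong (3 +_) c′≡1+c))))
  where
  c′≡1+c : c′ ≡ suc c
  c′≡1+c = suc-injective (trans (sym (at₀ B′)) (at₀ B))

Block-direction-unique : ∀ {f P c e e′} → Block f P c e → Block f P c e′ → e ≡ e′
Block-direction-unique {e = up}   {up}   _ _ = refl
Block-direction-unique {e = down} {down} _ _ = refl
Block-direction-unique {e = up}   {down} B B′ with trans (sym (at₀ B)) (at₀ B′)
... | ()
Block-direction-unique {e = down} {up}   B B′ with trans (sym (at₀ B)) (at₀ B′)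
... | ()

run⇒Block : ∀ f e {P} → Step e (f (2 + P)) (f P) → Step e (f P) (f (3 + P)) → Step e (f (3 + P)) (f (1 + P)) →
            SomeBlock f P
run⇒Block f up {P} a b c =
  f (2 + P) , up , block (sym a) (sym (trans (cong suc (trans (cong suc a) b)) c)) refl (sym (trans (cong suc a) b))
run⇒Block f down {P} a b c =
  f (1 + P) , down , block (sym (trans (cong suc c) b)) refl (sym (trans (cong suc (trans (cong suc c) b)) a)) (sym c)

module _ (f : ℕ → ℕ) where

  BlockPrefix : ℕ → Set
  BlockPrefix m = ∀ q → q < m → SomeBlock f (four q)

  InPrefix : ℕ → ℕ → Set
  InPrefix m x = ∃ λ y → y < four m × f y ≡ x

  InBlock⇒InPrefix : ∀ {m q x} → q < m → InBlock f (four q) x → InPrefix m x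
  InBlock⇒InPrefix q< (i , i< , e) = i + four _ , +four-mono-< q< i< , e

  BlockPrefix-extend : ∀ {m} → BlockPrefix m → SomeBlock f (four m) → BlockPrefix (suc m)
  BlockPrefix-extend {m} pre B q q< with m≤n⇒m<n∨m≡n q<
  ... | inj₁ q<m  = pre q (≤-pred q<m)
  ... | inj₂ refl = B

  consecutive-in-prefix : ∀ {m q y} → BlockPrefix m → suc q < four m → Consecutive (f q) y (f (suc q)) → InPrefix m y
  consecutive-in-prefix {m} {q} {y} pre lt mid with divMod4 q
  ... | q′ , i , i< , refl with +four-cancel-< {i} (<-trans (n<1+n _) lt)
  ...   | q′< with pre q′ q′<
  ...     | c , e , B = InBlock⇒InPrefix q′< (within i i< mid)
    where
    within : ∀ i → i < 4 → Consecutive (f (i + four q′)) y (f (suc (i + four q′))) → InBlock f (four q′) y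
    within 0 _ mid = Block-adjacent-first e B (Consecutive⇒Adjacentˡ mid)
    within 1 _ mid = ⊥-elim (Block-¬consecutive₁₂ e B mid)
    within 2 _ mid = Block-consecutive₂₃ e B mid
    within 3 _ mid = Block-adjacent-last e B (Consecutive⇒Adjacentˡ mid)
    within (suc (suc (suc (suc _)))) (s≤s (s≤s (s≤s (s≤s ())))) _

  adjacent-to-last-in-prefix : ∀ {m r x} → BlockPrefix m → four m ≡ suc r → Adjacent (f r) x → InPrefix m x
  adjacent-to-last-in-prefix {suc m} {r} {x} pre eq adj with pre m (n<1+n m)
  ... | c , e , B = InBlock⇒InPrefix (n<1+n m)
    (Block-adjacent-last e B (subst (λ z → Adjacent (f z) x) (sym (suc-injective eq)) adj))

module Decomposition (n : ℕ) (f : ℕ → ℕ) (f-injective : InjectiveBelow n f)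
                     (f-free : AdjacencyFree n f) (f-covered : Covered n f) where

  not-in-prefix : ∀ {m p} → four m ≤ p → p < n → ¬ InPrefix f m (f p)
  not-in-prefix le p< (y , y< , fy) =
    <-irrefl (f-injective y _ (<-trans (<-≤-trans y< le) p<) p< fy) (<-≤-trans y< le)

  -- f P, the first entry after the prefix, lies strictly between the values at j and j + 1;
  -- covering j and j + 1 forces j = P + 2 and the block P, …, P + 3.
  module Partner (m : ℕ) (pre : BlockPrefix f m) (P<n : four m < n) (e : Dir) (j : ℕ)
                 (2+P≤j : 2 + four m ≤ j) (1+j<n : suc j < n)
                 (j→P : Step e (f j) (f (four m))) (P→1+j : Step e (f (four m)) (f (suc j))) where

    P : ℕ
    P = four m

    j<n : j < n
    j<n = <-trans (n<1+n j) 1+j<n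

    1+P<n : suc P < n
    1+P<n = <-≤-trans (n<1+n (suc P)) (≤-trans 2+P≤j (<⇒≤ j<n))

    position-of-fP : ∀ {r} → r < n → f r ≡ f P → r ≡ P
    position-of-fP r< eq = f-injective _ P r< P<n eq


    j-covered : (∃ λ j′ → j ≡ suc j′ × Step e (f (suc j)) (f j′)) ⊎ Step e (f (suc P)) (f j)
    j-covered with f-covered j j<n
    ... | inj₁ (j′ , j≡ , _ , adj) with adjacent-to-target e P→1+j (Adjacent-sym adj)
    ...   | inj₂ st = inj₁ (j′ , j≡ , st)
    ...   | inj₁ e′ = ⊥-elim (<-irrefl (sym (cong suc (position-of-fP (predecessor< j≡ j<n) e′))) (subst (suc (suc P) ≤_) j≡ 2+P≤j))
    j-covered | inj₂ (r , 1+r< , mid) with consecutive-around-source e j→P mid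
    ... | inj₁ (e′ , st) = ⊥-elim (not-in-prefix (≤-trans (n≤1+n P) (≤-trans (n≤1+n (suc P)) 2+P≤j)) j<n
                                     (adjacent-to-last-in-prefix f pre (sym (position-of-fP 1+r< e′)) (e , st)))
    ... | inj₂ (e′ , st) = inj₂ (subst (λ z → Step e (f (suc z)) (f j)) (position-of-fP (predecessor< refl 1+r<) e′) st)

    1+j-covered : (suc (suc j) < n × Step e (f (suc (suc j))) (f j)) ⊎ Step e (f (suc j)) (f (suc P))
    1+j-covered with f-covered (suc j) 1+j<n
    ... | inj₁ (j′ , j≡ , 2+j< , adj)
      with adjacent-to-source e j→P (subst (λ z → Adjacent (f z) (f (suc (suc j)))) (sym (suc-injective j≡)) adj)
    ...   | inj₂ st = inj₁ (2+j< , st)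
    ...   | inj₁ e′ = ⊥-elim (<-irrefl (sym (position-of-fP 2+j< e′))
                               (<-≤-trans (n<1+n P) (≤-trans (n≤1+n (suc P)) (≤-trans 2+P≤j (≤-trans (n≤1+n j) (n≤1+n (suc j)))))))
    1+j-covered | inj₂ (r , 1+r< , mid) with consecutive-around-target e P→1+j mid
    ... | inj₁ (e′ , st) = ⊥-elim (not-in-prefix (≤-trans (n≤1+n P) (≤-trans (n≤1+n (suc P)) (≤-trans 2+P≤j (n≤1+n j)))) 1+j<n
                                     (adjacent-to-last-in-prefix f pre (sym (position-of-fP 1+r< e′)) (Adjacent-sym (e , st))))
    ... | inj₂ (e′ , st) = inj₂ (subst (λ z → Step e (f (suc j)) (f (suc z))) (position-of-fP (predecessor< refl 1+r<) e′) st)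

    -- The run f (j + 2) → f j → f P → f (j + 1) → f j′, with j′ = j - 1 ≠ P + 1, leaves j′ uncovered.
    no-longer-run : ∀ j′ → j ≡ suc j′ → suc P ≢ j′ → Step e (f (suc j)) (f j′) →
                    suc (suc j) < n → Step e (f (suc (suc j))) (f j) → ⊥
    no-longer-run j′ j≡ P+1≢j′ 1+j→j′ 2+j< 2+j→j with f-covered j′ (predecessor< j≡ j<n)
    ... | inj₁ (j″ , j′≡ , _ , adj)
      with adjacent-to-source e j→P (Adjacent-sym (subst (λ z → Adjacent (f j″) (f z)) (sym j≡) adj))
    ...   | inj₁ e′ = P+1≢j′ (sym (trans j′≡ (cong suc (position-of-fP (predecessor< j′≡ (predecessor< j≡ j<n)) e′))))
    ...   | inj₂ st = <-irrefl (f-injective j″ (suc (suc j)) (predecessor< j′≡ (predecessor< j≡ j<n)) 2+j< (Step-injective e st 2+j→j))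
                        (predecessor< j′≡ (predecessor< j≡ (<-trans (n<1+n j) (n<1+n (suc j)))))
    no-longer-run j′ j≡ P+1≢j′ 1+j→j′ 2+j< 2+j→j | inj₂ (r , 1+r< , mid) with consecutive-around-target e 1+j→j′ mid
    ... | inj₁ (e′ , st) = no-Step-4-cycle e j→P P→1+j 1+j→j′
                             (subst (λ z → Step e (f j′) (f z)) (suc-injective (f-injective _ _ 1+r< 1+j<n e′)) st)
    ... | inj₂ (e′ , st) = no-Step-5-cycle e j→P P→1+j 1+j→j′
                             (subst (λ z → Step e (f j′) (f (suc z))) (f-injective _ _ (<-trans (n<1+n r) 1+r<) 1+j<n e′) st) 2+j→j

    closing-block : ∀ j′ → j ≡ suc j′ → Step e (f (suc j)) (f j′) → j′ ≡ suc P → SomeBlock f P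
    closing-block j′ j≡ 1+j→j′ refl = run⇒Block f e (subst (λ z → Step e (f z) (f P)) j≡ j→P)
      (subst (λ z → Step e (f P) (f (suc z))) j≡ P→1+j) (subst (λ z → Step e (f (suc z)) (f (suc P))) j≡ 1+j→j′)

    next-block : SomeBlock f P
    next-block with j-covered | 1+j-covered
    ... | inj₂ P+1→j | inj₁ (2+j< , 2+j→j) =
      ⊥-elim (<-irrefl (f-injective _ _ 1+P<n 2+j< (Step-injective e P+1→j 2+j→j)) (<-trans 2+P≤j (<-trans (n<1+n j) (n<1+n (suc j)))))
    ... | inj₂ P+1→j | inj₂ 1+j→P+1 = ⊥-elim (no-Step-4-cycle e j→P P→1+j 1+j→P+1 P+1→j)
    ... | inj₁ (j′ , j≡ , 1+j→j′) | inj₂ 1+j→P+1 = closing-block j′ j≡ 1+j→j′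
        (f-injective _ _ (predecessor< j≡ j<n) 1+P<n (Step-functional e 1+j→j′ 1+j→P+1))
    ... | inj₁ (j′ , j≡ , 1+j→j′) | inj₁ (2+j< , 2+j→j) with j′ ≟ suc P
    ...   | yes j′≡ = closing-block j′ j≡ 1+j→j′ j′≡
    ...   | no j′≢ = ⊥-elim (no-longer-run j′ j≡ (λ e′ → j′≢ (sym e′)) 1+j→j′ 2+j< 2+j→j)

  next-block : ∀ m → BlockPrefix f m → four m < n → 3 + four m < n × SomeBlock f (four m)
  next-block m pre P<n with f-covered (four m) P<n
  ... | inj₁ (r , P≡ , 1+P< , adj) =
    ⊥-elim (not-in-prefix (n≤1+n _) 1+P< (adjacent-to-last-in-prefix f pre P≡ adj))
  ... | inj₂ (q , 1+q< , (e , q→P , P→1+q)) with <-cmp q (four m)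
  ...   | tri≈ _ refl _ = ⊥-elim (Step-irrefl e q→P)
  ...   | tri< q<P _ _ with m≤n⇒m<n∨m≡n q<P
  ...     | inj₂ 1+q≡P = ⊥-elim (Step-irrefl e (subst (λ z → Step e (f (four m)) (f z)) 1+q≡P P→1+q))
  ...     | inj₁ 1+q<P = ⊥-elim (not-in-prefix ≤-refl P<n (consecutive-in-prefix f pre 1+q<P (e , q→P , P→1+q)))
  next-block m pre P<n | inj₂ (q , 1+q< , (e , q→P , P→1+q)) | tri> _ _ P<q with m≤n⇒m<n∨m≡n P<q
  ...     | inj₂ refl   = ⊥-elim (f-free (four m) (<-trans (n<1+n _) 1+q<) (Adjacent-sym (e , q→P)))
  ...     | inj₁ 2+P≤q = ≤-<-trans (s≤s 2+P≤q) 1+q< , Partner.next-block m pre P<n e q 2+P≤q 1+q< q→P P→1+q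

  remaining≥4 : ∀ d P → 3 + P < suc d + P → ∃ λ d′ → d ≡ 3 + d′
  remaining≥4 (suc (suc (suc d′))) P _ = d′ , refl
  remaining≥4 zero                 P lt = ⊥-elim (<-irrefl refl (≤-trans lt (≤-trans (n≤1+n _) (n≤1+n _))))
  remaining≥4 (suc zero)           P lt = ⊥-elim (<-irrefl refl (≤-trans lt (n≤1+n _)))
  remaining≥4 (suc (suc zero))     P lt = ⊥-elim (<-irrefl refl lt)

  blocks-from : ∀ d m → d + four m ≡ n → BlockPrefix f m → ∃ λ k → n ≡ four k × BlockPrefix f k
  blocks-from zero    m eq pre = m , sym eq , pre
  blocks-from (suc d) m eq pre with next-block m pre (subst (four m <_) eq (m<n+m (four m) (s≤s z≤n)))
  ... | 3+P<n , B with remaining≥4 d (four m) (subst (3 + four m <_) (sym eq) 3+P<n)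
  ...   | d′ , refl = blocks-from d′ (suc m) (trans (+-suc⁴ d′ (four m)) eq) (BlockPrefix-extend f pre B)

  decomposition : ∃ λ k → n ≡ four k × BlockPrefix f k
  decomposition = blocks-from n 0 (+-identityʳ n) (λ _ ())

AlignedBlocks : ℕ → (ℕ → ℕ) → Set
AlignedBlocks k f = ∀ q → q < k → ∃ λ r → ∃ λ e → Block f (four q) (four r) e

-- The value just below the base of a block must be the top value of another block.
module Alignment (k : ℕ) (f : ℕ → ℕ) (f-injective : InjectiveBelow (four k) f) (pre : BlockPrefix f k)
                 (f< : ∀ p → p < four k → f p < four k)
                 (f-onto : ∀ x → x < four k → ∃ λ p → p < four k × f p ≡ x) where

  Location : ℕ → Set
  Location x = ∃ λ q → q < k × ∃ λ c → ∃ λ e → Block f (four q) c e × ∃ λ d → d < 4 × x ≡ d + c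

  locate : ∀ x → x < four k → Location x
  locate x x< with f-onto x x<
  ... | p , p< , fp with divMod4 p
  ... | q , i , i< , refl with +four-cancel-< {i} p<
  ... | q< with pre q q<
  ... | c , e , B with Block-values B i i<
  ... | d , d< , fv = q , q< , c , e , B , d , d< , trans (sym fp) fv

  location-unique : ∀ {q q′ c c′ e e′ d d′} → q < k → q′ < k → Block f (four q) c e → Block f (four q′) c′ e′ →
                    d < 4 → d′ < 4 → d + c ≡ d′ + c′ → c ≡ c′
  location-unique {d = d} {d′} q< q′< B B′ d< d′< eq
    with Block-covers B d d< | Block-covers B′ d′ d′<
  ... | i , i< , fi | i′ , i′< , fi′
    with divMod4-unique i< i′< (f-injective _ _ (+four-mono-< q< i<) (+four-mono-< q′< i′<) (trans fi (trans eq (sym fi′))))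
  ... | refl = Block-base-unique B B′

  base-aligned : ∀ c → ∀ {q e} → q < k → Block f (four q) c e → ∃ λ r → c ≡ four r
  base-aligned = <-rec _ aligned-below
    where
    aligned-below : ∀ c → (∀ {c′} → c′ < c → ∀ {q e} → q < k → Block f (four q) c′ e → ∃ λ r → c′ ≡ four r) →
                    ∀ {q e} → q < k → Block f (four q) c e → ∃ λ r → c ≡ four r
    aligned-below zero     _  _  _ = 0 , refl
    aligned-below (suc c′) ih q< B with locate c′ (<-trans (n<1+n c′) c<)
      where
      c< : suc c′ < four k
      c< with Block-covers B 0 0<4
      ... | i , i< , fi = subst (_< four k) fi (f< _ (+four-mono-< q< i<))
    ... | q′ , q′< , c″ , e′ , B′ , 3 , _ , refl with ih (s≤s (m≤n+m c″ 3)) q′< B′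
    ...   | r , refl = suc r , refl
    aligned-below (suc c′) ih q< B | q′ , q′< , c″ , e′ , B′ , 0 , _ , refl =
      ⊥-elim (1+n≢n (location-unique {d = 0} {1} q< q′< B B′ 0<4 1<4 refl))
    aligned-below (suc c′) ih q< B | q′ , q′< , c″ , e′ , B′ , 1 , _ , refl =
      ⊥-elim (m≢1+n+m c″ (sym (location-unique {d = 0} {2} q< q′< B B′ 0<4 2<4 refl)))
    aligned-below (suc c′) ih q< B | q′ , q′< , c″ , e′ , B′ , 2 , _ , refl =
      ⊥-elim (m≢1+n+m c″ (sym (location-unique {d = 0} {3} q< q′< B B′ 0<4 3<4 refl)))
    aligned-below (suc c′) ih q< B | _ , _ , _ , _ , _ , suc (suc (suc (suc _))) , s≤s (s≤s (s≤s (s≤s ()))) , _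

  aligned : AlignedBlocks k f
  aligned q q< with pre q q<
  ... | c , e , B with base-aligned c q< B
  ...   | r , refl = r , e , B

Block-inner-¬adjacent : ∀ {f P c} e → Block f P c e → ∀ i → i < 3 → ¬ Adjacent (f (i + P)) (f (suc i + P))
Block-inner-¬adjacent up   (block e₀ e₁ _  _ ) 0 _ adj with Adjacent-resp-≡ (sym e₀) (sym e₁) adj
... | up , ()
... | down , ()
Block-inner-¬adjacent down (block e₀ e₁ _  _ ) 0 _ adj with Adjacent-resp-≡ (sym e₀) (sym e₁) adj
... | up , ()
... | down , ()
Block-inner-¬adjacent up   (block _  e₁ e₂ _ ) 1 _ adj with Adjacent-resp-≡ (sym e₁) (sym e₂) adj
... | up , ()
... | down , ()
Block-inner-¬adjacent down (block _  e₁ e₂ _ ) 1 _ adj with Adjacent-resp-≡ (sym e₁) (sym e₂) adj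
... | up , ()
... | down , ()
Block-inner-¬adjacent up   (block _  _  e₂ e₃) 2 _ adj with Adjacent-resp-≡ (sym e₂) (sym e₃) adj
... | up , ()
... | down , ()
Block-inner-¬adjacent down (block _  _  e₂ e₃) 2 _ adj with Adjacent-resp-≡ (sym e₂) (sym e₃) adj
... | up , ()
... | down , ()
Block-inner-¬adjacent _ _ (suc (suc (suc _))) (s≤s (s≤s (s≤s ())))

Block-covered : ∀ {n f P c} e → Block f P c e → 4 + P ≤ n → ∀ i → i < 4 →
                CoveredByNeighbours n f (i + P) ⊎ CoveredAsMiddle n f (i + P)
Block-covered {P = P} up (block e₀ _ e₂ e₃) le 0 _ = inj₂ (2 + P , le , Consecutive-resp-≡ e₂ e₀ e₃ (up , refl , refl))
Block-covered {P = P} down (block e₀ _ e₂ e₃) le 0 _ = inj₂ (2 + P , le , Consecutive-resp-≡ e₂ e₀ e₃ (down , refl , refl))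
Block-covered {P = P} up (block e₀ _ e₂ _) le 1 _ = inj₁ (P , refl , ≤-trans (s≤s (s≤s (s≤s (n≤1+n _)))) le , Adjacent-resp-≡ e₀ e₂ (down , refl))
Block-covered {P = P} down (block e₀ _ e₂ _) le 1 _ = inj₁ (P , refl , ≤-trans (s≤s (s≤s (s≤s (n≤1+n _)))) le , Adjacent-resp-≡ e₀ e₂ (up , refl))
Block-covered {P = P} up (block _ e₁ _ e₃) le 2 _ = inj₁ (1 + P , refl , le , Adjacent-resp-≡ e₁ e₃ (down , refl))
Block-covered {P = P} down (block _ e₁ _ e₃) le 2 _ = inj₁ (1 + P , refl , le , Adjacent-resp-≡ e₁ e₃ (up , refl))
Block-covered {P = P} up (block e₀ e₁ _ e₃) le 3 _ =
  inj₂ (P , ≤-trans (s≤s (s≤s (n≤1+n _))) (≤-trans (n≤1+n _) le) , Consecutive-resp-≡ e₀ e₃ e₁ (up , refl , refl))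
Block-covered {P = P} down (block e₀ e₁ _ e₃) le 3 _ =
  inj₂ (P , ≤-trans (s≤s (s≤s (n≤1+n _))) (≤-trans (n≤1+n _) le) , Consecutive-resp-≡ e₀ e₃ e₁ (down , refl , refl))
Block-covered _ _ _ (suc (suc (suc (suc _)))) (s≤s (s≤s (s≤s (s≤s ()))))

blocks⇒adjacencyFree : ∀ k f → InjectiveBelow (four k) f → BlockPrefix f k → AdjacencyFree (four k) f
blocks⇒adjacencyFree k f f-injective pre p 1+p< adj with divMod4 p
... | q , i , i< , refl with +four-cancel-< {i} (<-trans (n<1+n _) 1+p<)
...   | q< with pre q q< | m≤n⇒m<n∨m≡n i<
...     | c , e , B | inj₁ (s≤s i<3) = Block-inner-¬adjacent e B i i<3 adj
...     | c , e , B | inj₂ refl with Block-adjacent-last e B adj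
...       | i′ , i′< , fi′ = <-irrefl (f-injective _ _ (+four-mono-< q< i′<) 1+p< fi′) (+-monoˡ-< (four q) i′<)

blocks⇒covered : ∀ k f → BlockPrefix f k → Covered (four k) f
blocks⇒covered k f pre p p< with divMod4 p
... | q , i , i< , refl with +four-cancel-< {i} p<
...   | q< with pre q q<
...     | c , e , B = Block-covered e B (four-mono-< q<) i i<

shift : ℕ → ℕ → ℕ
shift zero    x       = 4 + x
shift (suc c) zero    = zero
shift (suc c) (suc x) = suc (shift c x)

unshift : ℕ → ℕ → ℕ
unshift zero    x       = x ∸ 4
unshift (suc c) zero    = zero
unshift (suc c) (suc x) = suc (unshift c x)

shift-< : ∀ c x → x < c → shift c x ≡ x
shift-< (suc c) zero    _        = refl
shift-< (suc c) (suc x) (s≤s lt) = cong suc (shift-< c x lt)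

shift-≥ : ∀ c x → c ≤ x → shift c x ≡ 4 + x
shift-≥ zero    x       _        = refl
shift-≥ (suc c) (suc x) (s≤s le) = cong suc (shift-≥ c x le)

unshift-< : ∀ c x → x < c → unshift c x ≡ x
unshift-< (suc c) zero    _        = refl
unshift-< (suc c) (suc x) (s≤s lt) = cong suc (unshift-< c x lt)

unshift-shift : ∀ c y → unshift c (shift c y) ≡ y
unshift-shift zero    y       = refl
unshift-shift (suc c) zero    = refl
unshift-shift (suc c) (suc y) = cong suc (unshift-shift c y)

OutsideGap : ℕ → ℕ → Set
OutsideGap c x = x < c ⊎ 4 + c ≤ x

shift-unshift : ∀ c x → OutsideGap c x → shift c (unshift c x) ≡ x
shift-unshift zero    (suc (suc (suc (suc x)))) (inj₂ _)        = refl
shift-unshift (suc c) zero                      _               = refl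
shift-unshift (suc c) (suc x)                   (inj₁ (s≤s lt)) = cong suc (shift-unshift c x (inj₁ lt))
shift-unshift (suc c) (suc x)                   (inj₂ (s≤s le)) = cong suc (shift-unshift c x (inj₂ (subst (_≤ x) (sym (+-suc 3 c)) le)))
shift-unshift zero    (suc (suc (suc zero)))    (inj₂ (s≤s (s≤s (s≤s ()))))
shift-unshift zero    (suc (suc zero))          (inj₂ (s≤s (s≤s ())))
shift-unshift zero    (suc zero)                (inj₂ (s≤s ()))
shift-unshift zero    zero                      (inj₂ ())

shift-injective : ∀ c {x y} → shift c x ≡ shift c y → x ≡ y
shift-injective c {x} {y} e = trans (sym (unshift-shift c x)) (trans (cong (unshift c) e) (unshift-shift c y))

shift-avoids-gap : ∀ c d x → d < 4 → shift c x ≢ d + c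
shift-avoids-gap c d x d< e with <-cmp x c
... | tri< x<c _ _  = <-irrefl refl (<-≤-trans (subst (_< c) (trans (sym (shift-< c x x<c)) e) x<c) (m≤n+m c d))
... | tri≈ _ refl _ = <-irrefl (trans (sym e) (shift-≥ c x ≤-refl)) (+-monoˡ-< x d<)
... | tri> _ _ c<x  = <-irrefl refl (<-≤-trans (+-monoˡ-< c d<)
                        (≤-trans (+-monoʳ-≤ 4 (<⇒≤ c<x)) (≤-reflexive (trans (sym (shift-≥ c x (<⇒≤ c<x))) e))))

shift< : ∀ c N y → y < N → shift c y < 4 + N
shift< c N y y<N with <-cmp y c
... | tri< y<c _ _ = subst (_< 4 + N) (sym (shift-< c y y<c)) (≤-trans y<N (m≤n+m N 4))
... | tri≈ _ e _   = subst (_< 4 + N) (sym (shift-≥ c y (≤-reflexive (sym e)))) (+-monoʳ-< 4 y<N)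
... | tri> _ _ c<y = subst (_< 4 + N) (sym (shift-≥ c y (<⇒≤ c<y))) (+-monoʳ-< 4 y<N)

shift<-cancel : ∀ c N y → c ≤ N → shift c y < 4 + N → y < N
shift<-cancel c N y c≤N lt with <-cmp y c
... | tri< y<c _ _ = <-≤-trans y<c c≤N
... | tri≈ _ e _   = +-cancelˡ-< 4 y N (subst (_< 4 + N) (shift-≥ c y (≤-reflexive (sym e))) lt)
... | tri> _ _ c<y = +-cancelˡ-< 4 y N (subst (_< 4 + N) (shift-≥ c y (<⇒≤ c<y)) lt)

prependBlock : ℕ → Dir → (ℕ → ℕ) → ℕ → ℕ
prependBlock c e g (suc (suc (suc (suc p)))) = shift c (g p)
prependBlock c e g i                         = blockPattern e i + c

prependBlock-< : ∀ c e g i → i < 4 → prependBlock c e g i ≡ blockPattern e i + c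
prependBlock-< c e g 0 _ = refl
prependBlock-< c e g 1 _ = refl
prependBlock-< c e g 2 _ = refl
prependBlock-< c e g 3 _ = refl
prependBlock-< c e g (suc (suc (suc (suc _)))) (s≤s (s≤s (s≤s (s≤s ()))))

<4⊎4+ : ∀ p → p < 4 ⊎ ∃ λ p′ → p ≡ 4 + p′
<4⊎4+ 0                          = inj₁ 0<4
<4⊎4+ 1                          = inj₁ 1<4
<4⊎4+ 2                          = inj₁ 2<4
<4⊎4+ 3                          = inj₁ 3<4
<4⊎4+ (suc (suc (suc (suc p)))) = inj₂ (p , refl)

4+< : ∀ k p → p < four k → 4 + p < four (suc k)
4+< k p lt = s≤s (s≤s (s≤s (s≤s lt)))

prepend : ∀ k → Fin (suc k) → Dir → OneLine (four k) → OneLine (four (suc k))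
prepend k r e σ = oneLine (four (suc k)) (prependBlock (four (toℕ r)) e (nth σ))

module Prepend (k : ℕ) (r : Fin (suc k)) (e : Dir) (σ : OneLine (four k)) where

  c : ℕ
  c = four (toℕ r)

  g h : ℕ → ℕ
  g = nth σ
  h = prependBlock c e g

  τ : OneLine (four (suc k))
  τ = prepend k r e σ

  h< : ∀ p → p < four (suc k) → h p < four (suc k)
  h< p p< with <4⊎4+ p
  ... | inj₁ p<4 = subst (_< four (suc k)) (sym (prependBlock-< c e g p p<4))
                     (+-mono-<-≤ (blockPattern< e p) (four-mono-≤ (≤-pred (toℕ<n r))))
  ... | inj₂ (p′ , refl) = shift< c (four k) (g p′) (nth< σ p′ (+-cancelˡ-< 4 p′ (four k) p<))

  nth-τ : ∀ p → p < four (suc k) → nth τ p ≡ h p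
  nth-τ p p< = nth-oneLine (four (suc k)) h p p< (h< p p<)

  first-block : Block (nth τ) 0 c e
  first-block = Block-from (λ i i< → trans (nth-τ (i + 0) (≤-trans (+-monoˡ-< 0 i<) (s≤s (s≤s (s≤s (s≤s z≤n))))))
                                          (trans (cong h (+-identityʳ i)) (prependBlock-< c e g i i<)))

  nth-τ-4+ : ∀ p → p < four k → nth τ (4 + p) ≡ shift c (g p)
  nth-τ-4+ p p< = nth-τ (4 + p) (4+< k p p<)

  τ-injective : InjectiveBelow (four k) g → InjectiveBelow (four (suc k)) (nth τ)
  τ-injective g-injective p q p< q< e′ = h-injective (<4⊎4+ p) (<4⊎4+ q) (trans (sym (nth-τ p p<)) (trans e′ (nth-τ q q<)))
    where
    h-injective : p < 4 ⊎ ∃ (λ p′ → p ≡ 4 + p′) → q < 4 ⊎ ∃ (λ q′ → q ≡ 4 + q′) → h p ≡ h q → p ≡ q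
    h-injective (inj₁ p<4) (inj₁ q<4) eq = begin
      p                                           ≡⟨ blockPattern-inverseˡ e p p<4 ⟨
      blockPattern⁻¹ e (blockPattern e p)         ≡⟨ cong (blockPattern⁻¹ e) (+-cancelʳ-≡ c _ _ pattern-eq) ⟩
      blockPattern⁻¹ e (blockPattern e q)         ≡⟨ blockPattern-inverseˡ e q q<4 ⟩
      q                                           ∎
      where
      open ≡-Reasoning
      pattern-eq : blockPattern e p + c ≡ blockPattern e q + c
      pattern-eq = trans (sym (prependBlock-< c e g p p<4)) (trans eq (prependBlock-< c e g q q<4))
    h-injective (inj₁ p<4) (inj₂ (q′ , refl)) eq =
      ⊥-elim (shift-avoids-gap c _ (g q′) (blockPattern< e p) (trans (sym eq) (prependBlock-< c e g p p<4)))
    h-injective (inj₂ (p′ , refl)) (inj₁ q<4) eq =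
      ⊥-elim (shift-avoids-gap c _ (g p′) (blockPattern< e q) (trans eq (prependBlock-< c e g q q<4)))
    h-injective (inj₂ (p′ , refl)) (inj₂ (q′ , refl)) eq = cong (4 +_)
      (g-injective p′ q′ (+-cancelˡ-< 4 p′ (four k) p<) (+-cancelˡ-< 4 q′ (four k) q<) (shift-injective c eq))

  τ-block-at : ∀ q → q < k → ∀ {r′ e′} → Block g (four q) (four r′) e′ → ∀ i → i < 4 →
               nth τ (i + four (suc q)) ≡ shift c (blockPattern e′ i + four r′)
  τ-block-at q q< B′ i i< = trans (nth-τ _ (+four-mono-< (s≤s q<) i<))
                                  (trans (cong h (+-suc⁴ i (four q))) (cong (shift c) (Block-at B′ i i<)))

  -- Blocks below the new base keep their base, the others move up by four.
  τ-aligned : AlignedBlocks k g → AlignedBlocks (suc k) (nth τ)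
  τ-aligned aligned zero    _         = toℕ r , e , first-block
  τ-aligned aligned (suc q) (s≤s q<) with aligned q q<
  ... | r′ , e′ , B′ with <-cmp r′ (toℕ r)
  ...   | tri< r′<r _ _ = r′ , e′ , Block-from (λ i i< → trans (τ-block-at q q< B′ i i<)
                            (shift-< c _ (<-≤-trans (+-monoˡ-< (four r′) (blockPattern< e′ i)) (four-mono-< r′<r))))
  ...   | tri≈ _ r′≡r _ = suc r′ , e′ , Block-from (λ i i< → trans (τ-block-at q q< B′ i i<) (trans
                            (shift-≥ c _ (≤-trans (≤-reflexive (cong four (sym r′≡r))) (m≤n+m (four r′) _)))
                            (sym (+-suc⁴ (blockPattern e′ i) (four r′)))))
  ...   | tri> _ _ r<r′ = suc r′ , e′ , Block-from (λ i i< → trans (τ-block-at q q< B′ i i<) (trans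
                            (shift-≥ c _ (≤-trans (four-mono-≤ (<⇒≤ r<r′)) (m≤n+m (four r′) _)))
                            (sym (+-suc⁴ (blockPattern e′ i) (four r′)))))

module RemoveFirstBlock (k : ℕ) (σ : OneLine (four (suc k))) (perm : IsPerm σ)
                        (aligned : AlignedBlocks (suc k) (nth σ)) where

  f : ℕ → ℕ
  f = nth σ

  f-injective : InjectiveBelow (four (suc k)) f
  f-injective = IsPerm⇒injectiveBelow σ perm

  r₀ : ℕ
  r₀ = proj₁ (aligned 0 0<1+n)

  e₀ : Dir
  e₀ = proj₁ (proj₂ (aligned 0 0<1+n))

  c : ℕ
  c = four r₀

  B₀ : Block f 0 c e₀
  B₀ = proj₂ (proj₂ (aligned 0 0<1+n))

  r₀< : r₀ < suc k
  r₀< = +four-cancel-< {0} (<-≤-trans (s≤s (m≤n+m c _)) (subst (_< four (suc k)) (at₀ B₀) (nth< σ 0 0<1+n)))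

  i<4⇒i<4+p : ∀ {i} p → i < 4 → i + 0 < 4 + p
  i<4⇒i<4+p p i< = ≤-trans (+-monoˡ-< 0 i<) (≤-trans (≤-reflexive (+-identityʳ 4)) (m≤m+n 4 p))

  outside-gap : ∀ p → p < four k → OutsideGap c (f (4 + p))
  outside-gap p p< with f (4 + p) <? c | f (4 + p) <? 4 + c
  ... | yes lt | _       = inj₁ lt
  ... | no ¬lt | no ¬lt′ = inj₂ (≮⇒≥ ¬lt′)
  ... | no ¬lt | yes lt′ with Block-covers B₀ (f (4 + p) ∸ c) (+-cancelʳ-< c _ 4 (subst (_< 4 + c) (sym (m∸n+n≡m c≤)) lt′))
    where
    c≤ : c ≤ f (4 + p)
    c≤ = ≮⇒≥ ¬lt
  ...   | i , i< , fi = ⊥-elim (<-irrefl (f-injective _ _ (≤-trans (i<4⇒i<4+p p i<) (<⇒≤ (4+< k p p<))) (4+< k p p<)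
                                        (trans fi (m∸n+n≡m (≮⇒≥ ¬lt))))
                                     (i<4⇒i<4+p p i<))

  rest : ℕ → ℕ
  rest p = unshift c (f (4 + p))

  shift-rest : ∀ p → p < four k → shift c (rest p) ≡ f (4 + p)
  shift-rest p p< = shift-unshift c _ (outside-gap p p<)

  rest< : ∀ p → p < four k → rest p < four k
  rest< p p< = shift<-cancel c (four k) (rest p) (four-mono-≤ (≤-pred r₀<))
    (subst (_< four (suc k)) (sym (shift-rest p p<)) (nth< σ (4 + p) (4+< k p p<)))

  σ′ : OneLine (four k)
  σ′ = oneLine (four k) rest

  nth-σ′ : ∀ p → p < four k → nth σ′ p ≡ rest p
  nth-σ′ p p< = nth-oneLine (four k) rest p p< (rest< p p<)

  σ′-injective : InjectiveBelow (four k) (nth σ′)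
  σ′-injective p q p< q< eq = +-cancelˡ-≡ 4 p q (f-injective (4 + p) (4 + q) (4+< k p p<) (4+< k q q<)
    (trans (sym (shift-rest p p<)) (trans (cong (shift c) (trans (sym (nth-σ′ p p<)) (trans eq (nth-σ′ q q<)))) (shift-rest q q<))))

  σ′-block-at : ∀ q → q < k → ∀ {r′ e′} → Block f (four (suc q)) (four r′) e′ → ∀ i → i < 4 →
                nth σ′ (i + four q) ≡ unshift c (blockPattern e′ i + four r′)
  σ′-block-at q q< B′ i i< = trans (nth-σ′ _ (+four-mono-< q< i<))
    (cong (unshift c) (trans (cong f (sym (+-suc⁴ i (four q)))) (Block-at B′ i i<)))

  σ′-aligned : AlignedBlocks k (nth σ′)
  σ′-aligned q q< with aligned (suc q) (s≤s q<)
  ... | r′ , e′ , B′ with <-cmp r′ r₀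
  ...   | tri< r′<r₀ _ _ = r′ , e′ , Block-from (λ i i< → trans (σ′-block-at q q< B′ i i<)
                             (unshift-< c _ (<-≤-trans (+-monoˡ-< (four r′) (blockPattern< e′ i)) (four-mono-< r′<r₀))))
  ...   | tri≈ _ refl _ with Block-covers B′ 0 0<4 | Block-covers B₀ 0 0<4
  ...     | i , i< , fi | i′ , i′< , fi′ = ⊥-elim (<-irrefl
            (sym (f-injective _ _ (+four-mono-< (s≤s q<) i<) (≤-trans (+-monoˡ-< 0 i′<) (s≤s (s≤s (s≤s (s≤s z≤n)))))
                                  (trans fi (sym fi′))))
            (≤-trans (i<4⇒i<4+p (four q) i′<) (m≤n+m (four (suc q)) i)))
  σ′-aligned q q< | r′ , e′ , B′ | tri> _ _ r₀<r′ with r′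
  ... | suc r″ = r″ , e′ , Block-from (λ i i< → trans (σ′-block-at q q< B′ i i<) (trans
        (cong (unshift c) (trans (+-suc⁴ (blockPattern e′ i) (four r″))
                                 (sym (shift-≥ c _ (≤-trans (four-mono-≤ (≤-pred r₀<r′)) (m≤n+m (four r″) _))))))
        (unshift-shift c _)))

  σ≡prepend : σ ≡ prepend k (fromℕ< r₀<) e₀ σ′
  σ≡prepend = nth-ext σ _ λ p p< → sym (trans (Prepend.nth-τ k (fromℕ< r₀<) e₀ σ′ p p<) (entry p p< (<4⊎4+ p)))
    where
    c≡ : four (toℕ (fromℕ< r₀<)) ≡ c
    c≡ = cong four (toℕ-fromℕ< r₀<)
    entry : ∀ p → p < four (suc k) → p < 4 ⊎ ∃ (λ p′ → p ≡ 4 + p′) →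
            prependBlock (four (toℕ (fromℕ< r₀<))) e₀ (nth σ′) p ≡ f p
    entry p _ (inj₁ p<4) = begin
      prependBlock _ e₀ (nth σ′) p  ≡⟨ prependBlock-< _ e₀ _ p p<4 ⟩
      blockPattern e₀ p + _         ≡⟨ cong (blockPattern e₀ p +_) c≡ ⟩
      blockPattern e₀ p + c         ≡⟨ Block-at B₀ p p<4 ⟨
      f (p + 0)                     ≡⟨ cong f (+-identityʳ p) ⟩
      f p                           ∎
      where open ≡-Reasoning
    entry p p< (inj₂ (p′ , refl)) =
      trans (cong₂ shift c≡ (nth-σ′ p′ (+-cancelˡ-< 4 p′ (four k) p<))) (shift-rest p′ (+-cancelˡ-< 4 p′ (four k) p<))

directions : List Dir
directions = up ∷ down ∷ []

∈-directions : ∀ e → e ∈ directions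
∈-directions up   = here refl
∈-directions down = there (here refl)

prependWith : ∀ k → Fin (suc k) × Dir → OneLine (four k) → OneLine (four (suc k))
prependWith k (r , e) = prepend k r e

blockWords : (k : ℕ) → List (OneLine (four k))
blockWords zero    = [] ∷ []
blockWords (suc k) = cartesianProductWith (prependWith k) (cartesianProduct (allFin (suc k)) directions) (blockWords k)

∈-blockWords⇒ : ∀ k (σ : OneLine (four k)) → σ ∈ blockWords k → IsPerm σ × AlignedBlocks k (nth σ)
∈-blockWords⇒ zero    .[] (here refl) = (λ ()) , (λ _ ())
∈-blockWords⇒ (suc k) σ   σ∈ with ∈-cartesianProductWith⁻ (prependWith k) (cartesianProduct (allFin (suc k)) directions) (blockWords k) σ∈
... | (r , e) , σ′ , _ , σ′∈ , refl with ∈-blockWords⇒ k σ′ σ′∈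
...   | perm , aligned = injectiveBelow⇒IsPerm (prepend k r e σ′) (τ-injective (IsPerm⇒injectiveBelow σ′ perm)) ,
                         τ-aligned aligned
  where open Prepend k r e σ′

∈-blockWords⇐ : ∀ k (σ : OneLine (four k)) → IsPerm σ → AlignedBlocks k (nth σ) → σ ∈ blockWords k
∈-blockWords⇐ zero    []  _    _       = here refl
∈-blockWords⇐ (suc k) σ   perm aligned = subst (_∈ blockWords (suc k)) (sym σ≡prepend)
  (∈-cartesianProductWith⁺ (prependWith k) (∈-cartesianProduct⁺ (∈-allFin (fromℕ< r₀<)) (∈-directions e₀))
    (∈-blockWords⇐ k σ′ (injectiveBelow⇒IsPerm σ′ σ′-injective) σ′-aligned))
  where open RemoveFirstBlock k σ perm aligned

prependWith-injective : ∀ k {w x y z} → prependWith k w y ≡ prependWith k x z → w ≡ x × y ≡ z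
prependWith-injective k {r , e} {r′ , e′} {σ} {σ′} eq
  with Prepend.first-block k r e σ | subst (λ τ → Block (nth τ) 0 (four (toℕ r′)) e′) (sym eq) (Prepend.first-block k r′ e′ σ′)
... | B | B′ with toℕ-injective (four-injective (Block-base-unique B B′))
...   | refl with Block-direction-unique B B′
...     | refl = refl , nth-ext σ σ′ (λ p p< → shift-injective (four (toℕ r))
                          (trans (sym (Prepend.nth-τ-4+ k r e σ p p<))
                                 (trans (cong (λ τ → nth τ (4 + p)) eq) (Prepend.nth-τ-4+ k r e σ′ p p<))))

blockWords-unique : ∀ k → Unique (blockWords k)
blockWords-unique zero    = [] ∷ []
blockWords-unique (suc k) = cartesianProductWith⁺ (prependWith k) (prependWith-injective k)
  (cartesianProduct⁺ (allFin⁺ (suc k)) (((λ ()) ∷ []) ∷ [] ∷ [])) (blockWords-unique k)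

length-cartesianProductWith : ∀ {A B C : Set} (f : A → B → C) xs ys →
                              length (cartesianProductWith f xs ys) ≡ length xs * length ys
length-cartesianProductWith f []       ys = refl
length-cartesianProductWith f (x ∷ xs) ys =
  trans (length-++ (map (f x) ys)) (cong₂ _+_ (length-map (f x) ys) (length-cartesianProductWith f xs ys))

length-blockWords : ∀ k → length (blockWords k) ≡ 2 ^ k * k !
length-blockWords zero    = refl
length-blockWords (suc k) = begin
  length (blockWords (suc k))                                  ≡⟨ length-cartesianProductWith (prependWith k) (cartesianProduct (allFin (suc k)) directions) (blockWords k) ⟩
  length (cartesianProduct (allFin (suc k)) directions) * length (blockWords k)
                                                               ≡⟨ cong₂ _*_ choices (length-blockWords k) ⟩
  (suc k * 2) * (2 ^ k * k !)                                  ≡⟨ rearrange k (2 ^ k) (k !) ⟩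
  2 ^ suc k * suc k !                                          ∎
  where
  open ≡-Reasoning
  open +-*-Solver
  choices : length (cartesianProduct (allFin (suc k)) directions) ≡ suc k * 2
  choices = trans (length-cartesianProductWith _,_ (allFin (suc k)) directions) (cong (_* 2) (length-tabulate {n = suc k} (λ x → x)))
  rearrange : ∀ k x y → (suc k * 2) * (x * y) ≡ (2 * x) * (suc k * y)
  rearrange = solve 3 (λ k x y → ((con 1 :+ k) :* con 2) :* (x :* y) := (con 2 :* x) :* ((con 1 :+ k) :* y)) refl

princeless⇒blocks : ∀ {m} (σ : OneLine (suc m)) → PrincelessK σ → ∃ λ k → suc m ≡ four k × BlockPrefix (nth σ) k
princeless⇒blocks σ (perm , ink , no-prince) =
  Decomposition.decomposition _ (nth σ) (IsPerm⇒injectiveBelow σ perm) (InK⇒adjacencyFree σ ink)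
    (princeless⇒covered σ perm ink no-prince)

∈-blockWords⇔princeless : ∀ k (σ : OneLine (four (suc k))) → (σ ∈ blockWords (suc k)) ⇔ PrincelessK σ
∈-blockWords⇔princeless k σ = mk⇔ to from
  where
  to : σ ∈ blockWords (suc k) → PrincelessK σ
  to σ∈ with ∈-blockWords⇒ (suc k) σ σ∈
  ... | perm , aligned =
    perm , adjacencyFree⇒InK σ (blocks⇒adjacencyFree (suc k) (nth σ) σ-injective blocks) ,
    covered⇒princeless σ perm (blocks⇒covered (suc k) (nth σ) blocks)
    where
    σ-injective : InjectiveBelow (four (suc k)) (nth σ)
    σ-injective = IsPerm⇒injectiveBelow σ perm
    blocks : BlockPrefix (nth σ) (suc k)
    blocks q q< with aligned q q<
    ... | r , e , B = four r , e , B
  from : PrincelessK σ → σ ∈ blockWords (suc k)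
  from princeless@(perm , _ , _) with princeless⇒blocks σ princeless
  ... | k′ , n≡ , blocks with four-injective {suc k} {k′} n≡
  ...   | refl = ∈-blockWords⇐ (suc k) σ perm
                   (Alignment.aligned (suc k) (nth σ) (IsPerm⇒injectiveBelow σ perm) blocks (nth< σ)
                                      (IsPerm⇒surjectiveBelow σ perm))

-- The hypothesis 4 ≤ n only excludes n = 0, where the empty word is princeless.
mainTheorem9 : ∀ (n : ℕ) → 4 ≤ n →
    (∀ (k : ℕ) → n ≡ 4 * k → HasCount n PrincelessK (2 ^ k * k !)) ×
    (¬ (4 ∣ n) → HasCount n PrincelessK 0)
mainTheorem9 (suc m) _ = count , no-count
  where
  count : ∀ k → suc m ≡ 4 * k → HasCount (suc m) PrincelessK (2 ^ k * k !)
  count (suc k) n≡ = subst (λ n → HasCount n PrincelessK (2 ^ suc k * suc k !)) (trans (four≡4* (suc k)) (sym n≡))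
    (blockWords (suc k) , length-blockWords (suc k) , blockWords-unique (suc k) , ∈-blockWords⇔princeless k)
  no-count : ¬ (4 ∣ suc m) → HasCount (suc m) PrincelessK 0
  no-count 4∤n = [] , refl , [] , λ σ → mk⇔ (λ ()) λ princeless →
    let (k , n≡ , _) = princeless⇒blocks σ princeless in
    ⊥-elim (4∤n (divides k (trans n≡ (trans (four≡4* k) (*-comm 4 k)))))
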